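{- For a zerosumfree dagger monoidal additive category $\mathcal{C}$ there are indexed categories $\mathrm{pPred}\colon\dagger\text{ - }\mathrm{Iso}(\mathcal{C})^{\mathrm{op}}\to\mathbf{EMod}_{\mathrm{Pr}(\mathcal{C})}$ and $\mathrm{pPred}\colon\dagger\text{ - }\mathrm{Mono}(\mathcal{C})^{\mathrm{op}}\to\mathbf{EMod}_{\mathrm{Pr}(\mathcal{C})}$.
   Context: $\mathcal{C}$ is a dagger biproduct category (biproducts $\oplus$ with $(\pi_i)^\dagger=\kappa_i$) with additive inverses, zerosumfree ($f+g=0\Rightarrow f=g=0$ for positive $f,g$, positive meaning $g^\dagger\circ g$), and with a dagger symmetric monoidal structure $(I,\otimes)$ distributing over $\oplus$. A positive predicate on $X$ is $p=\langle p_1,p_2\rangle\colon X\to X\oplus X$ with $p_1+p_2=\mathrm{id}$, $p_i$ positive; $\mathrm{pPred}(X)$ is an effect algebra with $1=\kappa_1$, $0=\kappa_2$, swap as orthocomplement and partial sum $p\boxplus q=(\nabla+\mathrm{id})\circ b$ for a positive bound $b\colon X\to(X\oplus X)\oplus X$ with $[\mathrm{id},\kappa_2]\circ b=p$, $[[\kappa_2,\kappa_1],\kappa_2]\circ b=q$. $\mathrm{Pr}(\mathcal{C})=\mathrm{pPred}(I)$, the probabilities, form a commutative effect monoid under $p\cdot q=[p,\kappa_2]\circ q$. Probability multiplication: $s\bullet p=[\lambda\oplus\lambda,\kappa_2]\circ(\mathrm{dis}\oplus\mathrm{id})\circ((s\otimes\mathrm{id})\oplus\mathrm{id})\circ(\lambda^{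 -1}\oplus\mathrm{id})\circ p$, where $\mathrm{dis}\colon(X\oplus Y)\otimes Z\cong(X\otimes Z)\oplus(Y\otimes Z)$; this makes $\mathrm{pPred}(X)$ an effect module over $\mathrm{Pr}(\mathcal{C})$. $\mathbf{EMod}_M$ is the category of effect modules over $M$. $\dagger\text{ - }\mathrm{Iso}(\mathcal{C})$, $\dagger\text{ - }\mathrm{Mono}(\mathcal{C})$ are the subcategories of unitary maps, resp. dagger monos ($f^\dagger\circ f=\mathrm{id}$); substitution along such $f$ is $f^*(q)=(f^\dagger\oplus f^\dagger)\circ q\circ f$. Here $\boxplus$ denotes the partial sum operation. -}

module Defs where

open import Level using (Level; _⊔_; suc)
open import Data.Product using (Σ; _×_; _,_; ∃)
open import Relation.Binary using (Rel; IsEquivalence)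

record ZDMACategory (o ℓ e : Level) : Set (suc (o ⊔ ℓ ⊔ e)) where
  infixr 9 _∘_
  infix  4 _≈_
  infix  3 _⇒_
  infixl 6 _+_
  infixr 7 _⊕_ _⊕₁_
  infixr 8 _⊗_ _⊗₁_
  field
    Obj : Set o
    _⇒_ : Obj → Obj → Set ℓ
    _≈_ : ∀ {A B} → Rel (A ⇒ B) e
    ≈-equiv : ∀ {A B} → IsEquivalence (_≈_ {A} {B})
    id  : ∀ {A} → A ⇒ A
    _∘_ : ∀ {A B C} → B ⇒ C → A ⇒ B → A ⇒ C
    ∘-resp-≈ : ∀ {A B C} {f f' : B ⇒ C} {g g' : A ⇒ B} → f ≈ f' → g ≈ g' → f ∘ g ≈ f' ∘ g'
    assoc : ∀ {A B C D} {f : A ⇒ B} {g : B ⇒ C} {h : C ⇒ D} → (h ∘ g) ∘ f ≈ h ∘ (g ∘ f)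
    identityˡ : ∀ {A B} {f : A ⇒ B} → id ∘ f ≈ f
    identityʳ : ∀ {A B} {f : A ⇒ B} → f ∘ id ≈ f
    _† : ∀ {A B} → A ⇒ B → B ⇒ A
    †-resp-≈ : ∀ {A B} {f g : A ⇒ B} → f ≈ g → f † ≈ g †
    †-involutive : ∀ {A B} {f : A ⇒ B} → (f †) † ≈ f
    †-id : ∀ {A} → (id {A}) † ≈ id
    †-∘ : ∀ {A B C} {f : A ⇒ B} {g : B ⇒ C} → (g ∘ f) † ≈ f † ∘ g †
    _+_ : ∀ {A B} → A ⇒ B → A ⇒ B → A ⇒ B
    0h  : ∀ {A B} → A ⇒ B
    -_  : ∀ {A B} → A ⇒ B → A ⇒ B
    +-resp-≈ : ∀ {A B} {f f' g g' : A ⇒ B} → f ≈ f' → g ≈ g' → f + g ≈ f' + g'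
    neg-resp-≈ : ∀ {A B} {f f' : A ⇒ B} → f ≈ f' → - f ≈ - f'
    +-assoc : ∀ {A B} {f g h : A ⇒ B} → (f + g) + h ≈ f + (g + h)
    +-comm : ∀ {A B} {f g : A ⇒ B} → f + g ≈ g + f
    +-identityʳ : ∀ {A B} {f : A ⇒ B} → f + 0h ≈ f
    +-inverseʳ : ∀ {A B} {f : A ⇒ B} → f + (- f) ≈ 0h
    ∘-distribʳ-+ : ∀ {A B C} {f g : B ⇒ C} {h : A ⇒ B} → (f + g) ∘ h ≈ f ∘ h + g ∘ h
    ∘-distribˡ-+ : ∀ {A B C} {h : B ⇒ C} {f g : A ⇒ B} → h ∘ (f + g) ≈ h ∘ f + h ∘ g
    𝟘 : Obj
    𝟘-terminal : ∀ {A} (f g : A ⇒ 𝟘) → f ≈ g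
    𝟘-initial  : ∀ {A} (f g : 𝟘 ⇒ A) → f ≈ g
    _⊕_ : Obj → Obj → Obj
    π₁ : ∀ {A B} → A ⊕ B ⇒ A
    π₂ : ∀ {A B} → A ⊕ B ⇒ B
    κ₁ : ∀ {A B} → A ⇒ A ⊕ B
    κ₂ : ∀ {A B} → B ⇒ A ⊕ B
    π₁κ₁ : ∀ {A B} → π₁ ∘ κ₁ {A} {B} ≈ id
    π₂κ₂ : ∀ {A B} → π₂ ∘ κ₂ {A} {B} ≈ id
    π₁κ₂ : ∀ {A B} → π₁ ∘ κ₂ {A} {B} ≈ 0h
    π₂κ₁ : ∀ {A B} → π₂ ∘ κ₁ {A} {B} ≈ 0h
    κπ-sum : ∀ {A B} → κ₁ ∘ π₁ + κ₂ ∘ π₂ ≈ id {A ⊕ B}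
    π₁-† : ∀ {A B} → (π₁ {A} {B}) † ≈ κ₁
    π₂-† : ∀ {A B} → (π₂ {A} {B}) † ≈ κ₂

  ⟨_,_⟩ : ∀ {A B C} → A ⇒ B → A ⇒ C → A ⇒ B ⊕ C
  ⟨ f , g ⟩ = κ₁ ∘ f + κ₂ ∘ g

  [_,_] : ∀ {A B C} → A ⇒ C → B ⇒ C → A ⊕ B ⇒ C
  [ f , g ] = f ∘ π₁ + g ∘ π₂

  _⊕₁_ : ∀ {A B C D} → A ⇒ B → C ⇒ D → A ⊕ C ⇒ B ⊕ D
  f ⊕₁ g = κ₁ ∘ f ∘ π₁ + κ₂ ∘ g ∘ π₂

  ∇ : ∀ {A} → A ⊕ A ⇒ A
  ∇ = [ id , id ]

  swap : ∀ {A B} → A ⊕ B ⇒ B ⊕ A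
  swap = [ κ₂ , κ₁ ]

  Unitary : ∀ {A B} → A ⇒ B → Set e
  Unitary f = (f † ∘ f ≈ id) × (f ∘ f † ≈ id)

  DaggerMono : ∀ {A B} → A ⇒ B → Set e
  DaggerMono f = f † ∘ f ≈ id

  field
    I : Obj
    _⊗_ : Obj → Obj → Obj
    _⊗₁_ : ∀ {A B C D} → A ⇒ B → C ⇒ D → A ⊗ C ⇒ B ⊗ D
    ⊗-resp-≈ : ∀ {A B C D} {f f' : A ⇒ B} {g g' : C ⇒ D} → f ≈ f' → g ≈ g' → f ⊗₁ g ≈ f' ⊗₁ g'
    ⊗-id : ∀ {A B} → id {A} ⊗₁ id {B} ≈ id
    ⊗-∘ : ∀ {A B C A' B' C'} {f : A ⇒ B} {g : B ⇒ C} {f' : A' ⇒ B'} {g' : B' ⇒ C'}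
          → (g ∘ f) ⊗₁ (g' ∘ f') ≈ (g ⊗₁ g') ∘ (f ⊗₁ f')
    ⊗-† : ∀ {A B C D} {f : A ⇒ B} {g : C ⇒ D} → (f ⊗₁ g) † ≈ f † ⊗₁ g †
    α : ∀ {A B C} → (A ⊗ B) ⊗ C ⇒ A ⊗ (B ⊗ C)
    unitˡ : ∀ {A} → I ⊗ A ⇒ A
    unitʳ : ∀ {A} → A ⊗ I ⇒ A
    σ : ∀ {A B} → A ⊗ B ⇒ B ⊗ A
    α-unitary : ∀ {A B C} → Unitary (α {A} {B} {C})
    unitˡ-unitary : ∀ {A} → Unitary (unitˡ {A})
    unitʳ-unitary : ∀ {A} → Unitary (unitʳ {A})
    σ-unitary : ∀ {A B} → Unitary (σ {A} {B})
    α-natural : ∀ {A B C A' B' C'} {f : A ⇒ A'} {g : B ⇒ B'} {h : C ⇒ C'}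
                → α ∘ ((f ⊗₁ g) ⊗₁ h) ≈ (f ⊗₁ (g ⊗₁ h)) ∘ α
    unitˡ-natural : ∀ {A B} {f : A ⇒ B} → unitˡ ∘ (id {I} ⊗₁ f) ≈ f ∘ unitˡ
    unitʳ-natural : ∀ {A B} {f : A ⇒ B} → unitʳ ∘ (f ⊗₁ id {I}) ≈ f ∘ unitʳ
    σ-natural : ∀ {A B A' B'} {f : A ⇒ A'} {g : B ⇒ B'} → σ ∘ (f ⊗₁ g) ≈ (g ⊗₁ f) ∘ σ
    pentagon : ∀ {A B C D} → α {A} {B} {C ⊗ D} ∘ α {A ⊗ B} {C} {D}
                             ≈ (id ⊗₁ α) ∘ α ∘ (α ⊗₁ id)
    triangle : ∀ {A B} → (id {A} ⊗₁ unitˡ {B}) ∘ α ≈ unitʳ ⊗₁ id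
    hexagon : ∀ {A B C} → α {B} {C} {A} ∘ σ ∘ α {A} {B} {C}
                          ≈ (id ⊗₁ σ) ∘ α ∘ (σ ⊗₁ id)
    σ-involutive : ∀ {A B} → σ {B} {A} ∘ σ {A} {B} ≈ id
    dis : ∀ {A B C} → (A ⊕ B) ⊗ C ⇒ (A ⊗ C) ⊕ (B ⊗ C)
    dis-inverseˡ : ∀ {A B C} → dis {A} {B} {C} ∘ [ κ₁ ⊗₁ id , κ₂ ⊗₁ id ] ≈ id
    dis-inverseʳ : ∀ {A B C} → [ κ₁ ⊗₁ id , κ₂ ⊗₁ id ] ∘ dis {A} {B} {C} ≈ id

  Positive : ∀ {A} → A ⇒ A → Set (o ⊔ ℓ ⊔ e)
  Positive {A} f = Σ Obj (λ Z → Σ (A ⇒ Z) (λ g → f ≈ g † ∘ g))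

  field
    zerosumfree : ∀ {A} (f g : A ⇒ A) → Positive f → Positive g → f + g ≈ 0h
                  → (f ≈ 0h) × (g ≈ 0h)

  unitˡ⁻¹ : ∀ {A} → A ⇒ I ⊗ A
  unitˡ⁻¹ = unitˡ †

-- Effect algebras / monoids / modules, presented on a subset `In` of a
-- setoid carrier, with the partial sum given as a ternary relation
-- `Sum x y z`  meaning  "x ⊥ y and x ⊞ y = z".

record EARaw (c e : Level) : Set (suc (c ⊔ e)) where
  field
    Carrier : Set c
    _≈_ : Rel Carrier e
    In : Carrier → Set e
    Sum : Carrier → Carrier → Carrier → Set e
    one zero : Carrier
    _ᗮ : Carrier → Carrier

record IsEffectAlgebra {c e} (E : EARaw c e) : Set (c ⊔ e) where
  open EARaw E
  field
    ≈-equiv : IsEquivalence _≈_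
    In-resp : ∀ {x x'} → x ≈ x' → In x → In x'
    Sum-resp : ∀ {x x' y y' z z'} → x ≈ x' → y ≈ y' → z ≈ z' → Sum x y z → Sum x' y' z'
    In-one : In one
    In-zero : In zero
    In-ᗮ : ∀ {x} → In x → In (x ᗮ)
    ᗮ-resp : ∀ {x x'} → In x → x ≈ x' → (x ᗮ) ≈ (x' ᗮ)
    In-Sum : ∀ {x y z} → In x → In y → Sum x y z → In z
    Sum-functional : ∀ {x y z z'} → In x → In y → Sum x y z → Sum x y z' → z ≈ z'
    Sum-comm : ∀ {x y z} → In x → In y → Sum x y z → Sum y x z
    Sum-assoc : ∀ {x y z u v} → In x → In y → In z → Sum y z u → Sum x u v
                → Σ Carrier (λ w → In w × Sum x y w × Sum w z v)
    Sum-identity : ∀ {x} → In x → Sum x zero x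
    ᗮ-sum : ∀ {x} → In x → Sum x (x ᗮ) one
    ᗮ-unique : ∀ {x y} → In x → In y → Sum x y one → y ≈ (x ᗮ)
    zero-one : ∀ {x z} → In x → Sum x one z → x ≈ zero

record EMRaw (c e : Level) : Set (suc (c ⊔ e)) where
  field
    ea : EARaw c e
    _·_ : EARaw.Carrier ea → EARaw.Carrier ea → EARaw.Carrier ea
  open EARaw ea public

record IsCommEffectMonoid {c e} (M : EMRaw c e) : Set (c ⊔ e) where
  open EMRaw M
  field
    isEffectAlgebra : IsEffectAlgebra ea
    In-· : ∀ {a b} → In a → In b → In (a · b)
    ·-resp : ∀ {a a' b b'} → In a → In b → a ≈ a' → b ≈ b' → (a · b) ≈ (a' · b')
    ·-assoc : ∀ {a b d} → In a → In b → In d → ((a · b) · d) ≈ (a · (b · d))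
    ·-identityˡ : ∀ {a} → In a → (one · a) ≈ a
    ·-identityʳ : ∀ {a} → In a → (a · one) ≈ a
    ·-comm : ∀ {a b} → In a → In b → (a · b) ≈ (b · a)
    ·-Sumˡ : ∀ {a x y z} → In a → In x → In y → Sum x y z → Sum (a · x) (a · y) (a · z)
    ·-Sumʳ : ∀ {a x y z} → In a → In x → In y → Sum x y z → Sum (x · a) (y · a) (z · a)

record EModRaw {cm em} (M : EMRaw cm em) (c e : Level) : Set (suc (c ⊔ e) ⊔ cm) where
  field
    ea : EARaw c e
    _•_ : EMRaw.Carrier M → EARaw.Carrier ea → EARaw.Carrier ea
  open EARaw ea public

record IsEffectModule {cm em c e} (M : EMRaw cm em) (E : EModRaw M c e) : Set (cm ⊔ em ⊔ c ⊔ e) where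
  module M = EMRaw M
  open EModRaw E
  field
    isEffectAlgebra : IsEffectAlgebra ea
    In-• : ∀ {r x} → M.In r → In x → In (r • x)
    •-resp : ∀ {r r' x x'} → M.In r → In x → r M.≈ r' → x ≈ x' → (r • x) ≈ (r' • x')
    •-Sumˡ : ∀ {r s t x} → M.In r → M.In s → In x → M.Sum r s t → Sum (r • x) (s • x) (t • x)
    •-Sumʳ : ∀ {r x y z} → M.In r → In x → In y → Sum x y z → Sum (r • x) (r • y) (r • z)
    •-assoc : ∀ {r s x} → M.In r → M.In s → In x → ((r M.· s) • x) ≈ (r • (s • x))
    •-identity : ∀ {x} → In x → (M.one • x) ≈ x

record IsEModMorphism {cm em c e c' e'} (M : EMRaw cm em) (E : EModRaw M c e) (D : EModRaw M c' e')
                      (h : EModRaw.Carrier E → EModRaw.Carrier D) : Set (cm ⊔ em ⊔ c ⊔ e ⊔ e') where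
  module M = EMRaw M
  module E = EModRaw E
  module D = EModRaw D
  field
    In-h : ∀ {x} → E.In x → D.In (h x)
    h-resp : ∀ {x x'} → E.In x → x E.≈ x' → h x D.≈ h x'
    h-one : h E.one D.≈ D.one
    h-Sum : ∀ {x y z} → E.In x → E.In y → E.Sum x y z → D.Sum (h x) (h y) (h z)
    h-• : ∀ {r x} → M.In r → E.In x → h (r E.• x) D.≈ (r D.• h x)

module _ {o ℓ e} (C : ZDMACategory o ℓ e) where
  open ZDMACategory C

  IsPosPred : ∀ {X} → X ⇒ X ⊕ X → Set (o ⊔ ℓ ⊔ e)
  IsPosPred p = Positive (π₁ ∘ p) × Positive (π₂ ∘ p) × (π₁ ∘ p + π₂ ∘ p ≈ id)

  PPSum : ∀ {X} → X ⇒ X ⊕ X → X ⇒ X ⊕ X → X ⇒ X ⊕ X → Set (o ⊔ ℓ ⊔ e)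
  PPSum {X} p q r =
    Σ (X ⇒ (X ⊕ X) ⊕ X) λ b →
        Positive (π₁ ∘ π₁ ∘ b) × Positive (π₂ ∘ π₁ ∘ b) × Positive (π₂ ∘ b)
      × ([ id , κ₂ ] ∘ b ≈ p)
      × ([ [ κ₂ , κ₁ ] , κ₂ ] ∘ b ≈ q)
      × ((∇ ⊕₁ id) ∘ b ≈ r)

  pPredEA : Obj → EARaw ℓ (o ⊔ ℓ ⊔ e)
  pPredEA X = record
    { Carrier = X ⇒ X ⊕ X
    ; _≈_ = λ p q → Level.Lift (o ⊔ ℓ ⊔ e) (p ≈ q)
    ; In = IsPosPred
    ; Sum = PPSum
    ; one = κ₁
    ; zero = κ₂
    ; _ᗮ = λ p → swap ∘ p
    }

  Pr : EMRaw ℓ (o ⊔ ℓ ⊔ e)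
  Pr = record { ea = pPredEA I ; _·_ = λ p q → [ p , κ₂ ] ∘ q }

  scal : ∀ {X} → I ⇒ I ⊕ I → X ⇒ X ⊕ X → X ⇒ X ⊕ X
  scal s p = [ unitˡ ⊕₁ unitˡ , κ₂ ] ∘ (dis ⊕₁ id) ∘ ((s ⊗₁ id) ⊕₁ id) ∘ (unitˡ⁻¹ ⊕₁ id) ∘ p

  pPred : Obj → EModRaw Pr ℓ (o ⊔ ℓ ⊔ e)
  pPred X = record { ea = pPredEA X ; _•_ = scal }

  subst* : ∀ {X Y} → X ⇒ Y → Y ⇒ Y ⊕ Y → X ⇒ X ⊕ X
  subst* f q = (f † ⊕₁ f †) ∘ q ∘ f

  -- pPred is an indexed category  Cls(C)^op → EMod_{Pr(C)}, where Cls
  -- picks out the morphisms of a (wide) subcategory of C.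
  record IsIndexedEMod (Cls : ∀ {A B} → A ⇒ B → Set e) : Set (suc (o ⊔ ℓ ⊔ e)) where
    field
      cls-id : ∀ {A} → Cls (id {A})
      cls-∘ : ∀ {A B D} {f : A ⇒ B} {g : B ⇒ D} → Cls f → Cls g → Cls (g ∘ f)
      Pr-isCommEffectMonoid : IsCommEffectMonoid Pr
      pPred-isEffectModule : ∀ X → IsEffectModule Pr (pPred X)
      subst-isMorphism : ∀ {X Y} (f : X ⇒ Y) → Cls f
                         → IsEModMorphism Pr (pPred Y) (pPred X) (subst* f)
      subst-resp : ∀ {X Y} {f f' : X ⇒ Y} → Cls f → Cls f' → f ≈ f'
                   → ∀ q → IsPosPred q → subst* f q ≈ subst* f' q
      subst-id : ∀ {X} (q : X ⇒ X ⊕ X) → IsPosPred q → subst* id q ≈ q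
      subst-∘ : ∀ {X Y Z} {f : X ⇒ Y} {g : Y ⇒ Z} → Cls f → Cls g
                → ∀ q → IsPosPred q → subst* (g ∘ f) q ≈ subst* f (subst* g q)

module Submission where

-- Every positive predicate p = ⟨p₁, p₂⟩ on X is determined by its first
-- component p₁, because p₂ = id − p₁.  All the structure on pPred(X) acts
-- componentwise on these endomorphisms:
--   * the orthocomplement swaps p₁ and p₂,
--   * a partial sum p ⊞ q adds first components, and a bound witnessing it
--     amounts to positive a, b, c with p = (a, b+c), q = (b, a+c),
--     p ⊞ q = (a+b, c)  ('Decomposition'),
--   * the product of probabilities composes first components,
--   * the action of a probability s composes with the scalar action of s₁,
--     act s₁ = λ ∘ (s₁ ⊗ id) ∘ λ†, a central rig map (I ⇒ I) → (X ⇒ X),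
--   * substitution along f conjugates:  p₁ ↦ f† ∘ p₁ ∘ f.  The theorem follows for every wide subcategory consisting
-- of dagger monos, in particular for unitaries and for dagger monos.

open import Level using (lift; lower; _⊔_)
open import Defs
open import Data.Product using (_×_; _,_; Σ; proj₁; proj₂)
open import Relation.Binary using (IsEquivalence)
import Relation.Binary.Reasoning.Setoid as SetoidReasoning
open import Algebra.Bundles using (AbelianGroup)
import Algebra.Properties.Group as GroupProperties
import Algebra.Solver.CommutativeMonoid as CommutativeMonoidSolver

module Proof {o ℓ e} (C : ZDMACategory o ℓ e) where
  open ZDMACategory C

  module ≈ {A B} = IsEquivalence (≈-equiv {A} {B})
  open ≈ using (refl; sym; trans)

  infixr 9 _⟩∘⟨_
  _⟩∘⟨_ : ∀ {A B D} {f f' : B ⇒ D} {g g' : A ⇒ B} → f ≈ f' → g ≈ g' → f ∘ g ≈ f' ∘ g'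
  _⟩∘⟨_ = ∘-resp-≈

  infixl 6 _⟩+⟨_
  _⟩+⟨_ : ∀ {A B} {f f' g g' : A ⇒ B} → f ≈ f' → g ≈ g' → f + g ≈ f' + g'
  _⟩+⟨_ = +-resp-≈

  infixr 8 _⟩⊗⟨_
  _⟩⊗⟨_ : ∀ {A B D F} {f f' : A ⇒ B} {g g' : D ⇒ F} → f ≈ f' → g ≈ g' → f ⊗₁ g ≈ f' ⊗₁ g'
  _⟩⊗⟨_ = ⊗-resp-≈

  infixr 7 _⟩⊕⟨_
  _⟩⊕⟨_ : ∀ {A B D F} {f f' : A ⇒ B} {g g' : D ⇒ F} → f ≈ f' → g ≈ g' → f ⊕₁ g ≈ f' ⊕₁ g'
  ef ⟩⊕⟨ eg = (refl ⟩∘⟨ ef ⟩∘⟨ refl) ⟩+⟨ (refl ⟩∘⟨ eg ⟩∘⟨ refl)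

  [_⟩,⟨_] : ∀ {A B D} {f f' : A ⇒ D} {g g' : B ⇒ D} → f ≈ f' → g ≈ g' → [ f , g ] ≈ [ f' , g' ]
  [ ef ⟩,⟨ eg ] = (ef ⟩∘⟨ refl) ⟩+⟨ (eg ⟩∘⟨ refl)

  homGroup : Obj → Obj → AbelianGroup ℓ e
  homGroup A B = record
    { Carrier = A ⇒ B ; _≈_ = _≈_ ; _∙_ = _+_ ; ε = 0h ; _⁻¹ = -_
    ; isAbelianGroup = record
      { isGroup = record
        { isMonoid = record
          { isSemigroup = record
            { isMagma = record { isEquivalence = ≈-equiv ; ∙-cong = +-resp-≈ }
            ; assoc = λ _ _ _ → +-assoc }
          ; identity = (λ _ → trans +-comm +-identityʳ) , (λ _ → +-identityʳ) }
        ; inverse = (λ _ → trans +-comm +-inverseʳ) , (λ _ → +-inverseʳ)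
        ; ⁻¹-cong = neg-resp-≈ }
      ; comm = λ _ _ → +-comm } }

  module Hom {A B} = AbelianGroup (homGroup A B)
  module HomProperties {A B} = GroupProperties (Hom.group {A} {B})
  module HomSolver {A B} = CommutativeMonoidSolver (Hom.commutativeMonoid {A} {B})
  open module Reasoning {A B} = SetoidReasoning (Hom.setoid {A} {B})

  +-identityˡ : ∀ {A B} {f : A ⇒ B} → 0h + f ≈ f
  +-identityˡ = Hom.identityˡ _

  +-cancelˡ : ∀ {A B} {a b c : A ⇒ B} → a + b ≈ a + c → b ≈ c
  +-cancelˡ = HomProperties.∙-cancelˡ _ _ _

  idempotent⇒0 : ∀ {A B} {x : A ⇒ B} → x + x ≈ x → x ≈ 0h
  idempotent⇒0 = HomProperties.identityʳ-unique _ _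

  ∘-zeroʳ : ∀ {A B D} {f : B ⇒ D} → f ∘ 0h {A} {B} ≈ 0h
  ∘-zeroʳ = idempotent⇒0 (trans (sym ∘-distribˡ-+) (refl ⟩∘⟨ +-identityʳ))

  ∘-zeroˡ : ∀ {A B D} {f : A ⇒ B} → 0h {B} {D} ∘ f ≈ 0h
  ∘-zeroˡ = idempotent⇒0 (trans (sym ∘-distribʳ-+) (+-identityʳ ⟩∘⟨ refl))

  extendʳ : ∀ {A B D F G} {a : B ⇒ D} {f : A ⇒ B} {g : G ⇒ D} {b : A ⇒ G} {h : F ⇒ A}
          → a ∘ f ≈ g ∘ b → a ∘ (f ∘ h) ≈ g ∘ (b ∘ h)
  extendʳ eq = trans (sym assoc) (trans (eq ⟩∘⟨ refl) assoc)

  π₁⟨⟩ : ∀ {A B D} {f : A ⇒ B} {g : A ⇒ D} → π₁ ∘ ⟨ f , g ⟩ ≈ f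
  π₁⟨⟩ {f = f} {g} = begin
    π₁ ∘ (κ₁ ∘ f + κ₂ ∘ g)            ≈⟨ ∘-distribˡ-+ ⟩
    π₁ ∘ (κ₁ ∘ f) + π₁ ∘ (κ₂ ∘ g)     ≈⟨ sym assoc ⟩+⟨ sym assoc ⟩
    (π₁ ∘ κ₁) ∘ f + (π₁ ∘ κ₂) ∘ g     ≈⟨ (π₁κ₁ ⟩∘⟨ refl) ⟩+⟨ (π₁κ₂ ⟩∘⟨ refl) ⟩
    id ∘ f + 0h ∘ g                   ≈⟨ identityˡ ⟩+⟨ ∘-zeroˡ ⟩
    f + 0h                            ≈⟨ +-identityʳ ⟩
    f                                 ∎

  π₂⟨⟩ : ∀ {A B D} {f : A ⇒ B} {g : A ⇒ D} → π₂ ∘ ⟨ f , g ⟩ ≈ g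
  π₂⟨⟩ {f = f} {g} = begin
    π₂ ∘ (κ₁ ∘ f + κ₂ ∘ g)            ≈⟨ ∘-distribˡ-+ ⟩
    π₂ ∘ (κ₁ ∘ f) + π₂ ∘ (κ₂ ∘ g)     ≈⟨ sym assoc ⟩+⟨ sym assoc ⟩
    (π₂ ∘ κ₁) ∘ f + (π₂ ∘ κ₂) ∘ g     ≈⟨ (π₂κ₁ ⟩∘⟨ refl) ⟩+⟨ (π₂κ₂ ⟩∘⟨ refl) ⟩
    0h ∘ f + id ∘ g                   ≈⟨ ∘-zeroˡ ⟩+⟨ identityˡ ⟩
    0h + g                            ≈⟨ +-identityˡ ⟩
    g                                 ∎

  ⟨⟩-η : ∀ {A B D} {h : A ⇒ B ⊕ D} → h ≈ ⟨ π₁ ∘ h , π₂ ∘ h ⟩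
  ⟨⟩-η {h = h} = begin
    h                                  ≈⟨ sym identityˡ ⟩
    id ∘ h                             ≈⟨ sym κπ-sum ⟩∘⟨ refl ⟩
    (κ₁ ∘ π₁ + κ₂ ∘ π₂) ∘ h            ≈⟨ ∘-distribʳ-+ ⟩
    (κ₁ ∘ π₁) ∘ h + (κ₂ ∘ π₂) ∘ h      ≈⟨ assoc ⟩+⟨ assoc ⟩
    κ₁ ∘ (π₁ ∘ h) + κ₂ ∘ (π₂ ∘ h)      ∎

  ⊕-ext : ∀ {A B D} {h k : A ⇒ B ⊕ D} → π₁ ∘ h ≈ π₁ ∘ k → π₂ ∘ h ≈ π₂ ∘ k → h ≈ k
  ⊕-ext e₁ e₂ = trans ⟨⟩-η (trans ((refl ⟩∘⟨ e₁) ⟩+⟨ (refl ⟩∘⟨ e₂)) (sym ⟨⟩-η))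

  []∘ : ∀ {A B D F} {f : B ⇒ F} {g : D ⇒ F} {h : A ⇒ B ⊕ D}
      → [ f , g ] ∘ h ≈ f ∘ (π₁ ∘ h) + g ∘ (π₂ ∘ h)
  []∘ = trans ∘-distribʳ-+ (assoc ⟩+⟨ assoc)

  ∘[] : ∀ {A B D F} {h : F ⇒ D} {f : A ⇒ F} {g : B ⇒ F} → h ∘ [ f , g ] ≈ [ h ∘ f , h ∘ g ]
  ∘[] = trans ∘-distribˡ-+ (sym assoc ⟩+⟨ sym assoc)

  []∘⟨⟩ : ∀ {A B D F} {f : B ⇒ F} {g : D ⇒ F} {x : A ⇒ B} {y : A ⇒ D}
        → [ f , g ] ∘ ⟨ x , y ⟩ ≈ f ∘ x + g ∘ y
  []∘⟨⟩ = trans []∘ ((refl ⟩∘⟨ π₁⟨⟩) ⟩+⟨ (refl ⟩∘⟨ π₂⟨⟩))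

  []κ₁ : ∀ {B D F} {f : B ⇒ F} {g : D ⇒ F} → [ f , g ] ∘ κ₁ ≈ f
  []κ₁ = trans []∘ (trans ((refl ⟩∘⟨ π₁κ₁) ⟩+⟨ (refl ⟩∘⟨ π₂κ₁))
                          (trans (identityʳ ⟩+⟨ ∘-zeroʳ) +-identityʳ))

  []κ₂ : ∀ {B D F} {f : B ⇒ F} {g : D ⇒ F} → [ f , g ] ∘ κ₂ ≈ g
  []κ₂ = trans []∘ (trans ((refl ⟩∘⟨ π₁κ₂) ⟩+⟨ (refl ⟩∘⟨ π₂κ₂))
                          (trans (∘-zeroʳ ⟩+⟨ identityʳ) +-identityˡ))

  [id,0]≈π₁ : ∀ {A B} → [ id , 0h ] ≈ π₁ {A} {B}
  [id,0]≈π₁ = trans (identityˡ ⟩+⟨ ∘-zeroˡ) +-identityʳ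

  [0,id]≈π₂ : ∀ {A B} → [ 0h , id ] ≈ π₂ {A} {B}
  [0,id]≈π₂ = trans (∘-zeroˡ ⟩+⟨ identityˡ) +-identityˡ

  π₂⊕id : ∀ {A B D G} {f : A ⇒ B} {h : G ⇒ A ⊕ D} → π₂ ∘ ((f ⊕₁ id {D}) ∘ h) ≈ π₂ ∘ h
  π₂⊕id = trans (extendʳ π₂⟨⟩) identityˡ

  π₁κ₁∘ : ∀ {A B D} {y : A ⇒ B} → π₁ ∘ (κ₁ {B} {D} ∘ y) ≈ y
  π₁κ₁∘ = trans (sym assoc) (trans (π₁κ₁ ⟩∘⟨ refl) identityˡ)

  π₂κ₂∘ : ∀ {A B D} {y : A ⇒ D} → π₂ ∘ (κ₂ {B} {D} ∘ y) ≈ y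
  π₂κ₂∘ = trans (sym assoc) (trans (π₂κ₂ ⟩∘⟨ refl) identityˡ)

  π₁κ₂∘ : ∀ {A B D} {y : A ⇒ D} → π₁ ∘ (κ₂ {B} {D} ∘ y) ≈ 0h
  π₁κ₂∘ = trans (sym assoc) (trans (π₁κ₂ ⟩∘⟨ refl) ∘-zeroˡ)

  π₂κ₁∘ : ∀ {A B D} {y : A ⇒ B} → π₂ ∘ (κ₁ {B} {D} ∘ y) ≈ 0h
  π₂κ₁∘ = trans (sym assoc) (trans (π₂κ₁ ⟩∘⟨ refl) ∘-zeroˡ)

  †κ₁ : ∀ {A B D} {h : A ⇒ B ⊕ D} → h † ∘ κ₁ ≈ (π₁ ∘ h) †
  †κ₁ = trans (refl ⟩∘⟨ sym π₁-†) (sym †-∘)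

  †κ₂ : ∀ {A B D} {h : A ⇒ B ⊕ D} → h † ∘ κ₂ ≈ (π₂ ∘ h) †
  †κ₂ = trans (refl ⟩∘⟨ sym π₂-†) (sym †-∘)

  †-copair : ∀ {A B D} {h : A ⇒ B ⊕ D} → h † ≈ [ (π₁ ∘ h) † , (π₂ ∘ h) † ]
  †-copair {h = h} = begin
    h †                                  ≈⟨ sym identityʳ ⟩
    h † ∘ id                             ≈⟨ refl ⟩∘⟨ sym κπ-sum ⟩
    h † ∘ (κ₁ ∘ π₁ + κ₂ ∘ π₂)            ≈⟨ ∘-distribˡ-+ ⟩
    h † ∘ (κ₁ ∘ π₁) + h † ∘ (κ₂ ∘ π₂)    ≈⟨ sym assoc ⟩+⟨ sym assoc ⟩
    (h † ∘ κ₁) ∘ π₁ + (h † ∘ κ₂) ∘ π₂    ≈⟨ (†κ₁ ⟩∘⟨ refl) ⟩+⟨ (†κ₂ ⟩∘⟨ refl) ⟩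
    [ (π₁ ∘ h) † , (π₂ ∘ h) † ]          ∎

  ⟨⟩-† : ∀ {A B D} {f : A ⇒ B} {g : A ⇒ D} → ⟨ f , g ⟩ † ≈ [ f † , g † ]
  ⟨⟩-† = trans †-copair [ †-resp-≈ π₁⟨⟩ ⟩,⟨ †-resp-≈ π₂⟨⟩ ]

  pos-resp : ∀ {A} {f f' : A ⇒ A} → f ≈ f' → Positive f → Positive f'
  pos-resp eq (Z , g , pg) = Z , g , trans (sym eq) pg

  pos-id : ∀ {A} → Positive (id {A})
  pos-id = _ , id , sym (trans (†-id ⟩∘⟨ refl) identityˡ)

  pos-0 : ∀ {A} → Positive (0h {A} {A})
  pos-0 {A} = A , 0h , sym ∘-zeroʳ

  pos-+ : ∀ {A} {f g : A ⇒ A} → Positive f → Positive g → Positive (f + g)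
  pos-+ {f = f} {g} (Z , a , pa) (W , b , pb) = Z ⊕ W , ⟨ a , b ⟩ , (begin
    f + g                       ≈⟨ pa ⟩+⟨ pb ⟩
    a † ∘ a + b † ∘ b           ≈⟨ sym []∘⟨⟩ ⟩
    [ a † , b † ] ∘ ⟨ a , b ⟩   ≈⟨ sym ⟨⟩-† ⟩∘⟨ refl ⟩
    ⟨ a , b ⟩ † ∘ ⟨ a , b ⟩     ∎)

  pos-conj : ∀ {A B} {p : B ⇒ B} (f : A ⇒ B) → Positive p → Positive (f † ∘ p ∘ f)
  pos-conj {p = p} f (Z , g , pg) = Z , g ∘ f , (begin
    f † ∘ p ∘ f                 ≈⟨ refl ⟩∘⟨ pg ⟩∘⟨ refl ⟩
    f † ∘ (g † ∘ g) ∘ f         ≈⟨ refl ⟩∘⟨ assoc ⟩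
    f † ∘ g † ∘ g ∘ f           ≈⟨ sym assoc ⟩
    (f † ∘ g †) ∘ g ∘ f         ≈⟨ sym †-∘ ⟩∘⟨ refl ⟩
    (g ∘ f) † ∘ g ∘ f           ∎)

  ⊗-∘ˡ : ∀ {A B D F} {f : B ⇒ D} {g : A ⇒ B} → (f ∘ g) ⊗₁ id {F} ≈ (f ⊗₁ id) ∘ (g ⊗₁ id)
  ⊗-∘ˡ = trans (refl ⟩⊗⟨ sym identityˡ) ⊗-∘

  ⊗-∘ʳ : ∀ {A B D F} {f : B ⇒ D} {g : A ⇒ B} → id {F} ⊗₁ (f ∘ g) ≈ (id ⊗₁ f) ∘ (id ⊗₁ g)
  ⊗-∘ʳ = trans (sym identityˡ ⟩⊗⟨ refl) ⊗-∘

  ⊗-interchange : ∀ {A B D F} {u : A ⇒ B} {h : D ⇒ F}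
                → (u ⊗₁ id) ∘ (id ⊗₁ h) ≈ (id ⊗₁ h) ∘ (u ⊗₁ id)
  ⊗-interchange = trans (sym ⊗-∘) (trans (trans identityʳ (sym identityˡ) ⟩⊗⟨ trans identityˡ (sym identityʳ)) ⊗-∘)

  λ†λ : ∀ {A} → unitˡ {A} † ∘ unitˡ ≈ id
  λ†λ = proj₁ unitˡ-unitary

  λλ† : ∀ {A} → unitˡ {A} ∘ unitˡ † ≈ id
  λλ† = proj₂ unitˡ-unitary

  cancelʳ : ∀ {A B D} {x y : B ⇒ D} {u : A ⇒ B} {u' : B ⇒ A} → u ∘ u' ≈ id → x ∘ u ≈ y ∘ u → x ≈ y
  cancelʳ {x = x} {y} {u} {u'} inv eq = begin
    x                ≈⟨ sym identityʳ ⟩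
    x ∘ id           ≈⟨ refl ⟩∘⟨ sym inv ⟩
    x ∘ u ∘ u'       ≈⟨ sym assoc ⟩
    (x ∘ u) ∘ u'     ≈⟨ eq ⟩∘⟨ refl ⟩
    (y ∘ u) ∘ u'     ≈⟨ assoc ⟩
    y ∘ u ∘ u'       ≈⟨ refl ⟩∘⟨ inv ⟩
    y ∘ id           ≈⟨ identityʳ ⟩
    y                ∎

  cancelˡ : ∀ {A B D} {x y : A ⇒ B} {u : B ⇒ D} {u' : D ⇒ B} → u' ∘ u ≈ id → u ∘ x ≈ u ∘ y → x ≈ y
  cancelˡ {x = x} {y} {u} {u'} inv eq = begin
    x                ≈⟨ sym identityˡ ⟩
    id ∘ x           ≈⟨ sym inv ⟩∘⟨ refl ⟩
    (u' ∘ u) ∘ x     ≈⟨ assoc ⟩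
    u' ∘ u ∘ x       ≈⟨ refl ⟩∘⟨ eq ⟩
    u' ∘ u ∘ y       ≈⟨ sym assoc ⟩
    (u' ∘ u) ∘ y     ≈⟨ inv ⟩∘⟨ refl ⟩
    id ∘ y           ≈⟨ identityˡ ⟩
    y                ∎

  λ-conj : ∀ {A B} {f : A ⇒ B} → unitˡ ∘ (id ⊗₁ f) ∘ unitˡ † ≈ f
  λ-conj {f = f} = begin
    unitˡ ∘ (id ⊗₁ f) ∘ unitˡ †       ≈⟨ sym assoc ⟩
    (unitˡ ∘ (id ⊗₁ f)) ∘ unitˡ †     ≈⟨ unitˡ-natural ⟩∘⟨ refl ⟩
    (f ∘ unitˡ) ∘ unitˡ †             ≈⟨ assoc ⟩
    f ∘ unitˡ ∘ unitˡ †               ≈⟨ refl ⟩∘⟨ λλ† ⟩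
    f ∘ id                            ≈⟨ identityʳ ⟩
    f                                 ∎

  ρ-conj : ∀ {A B} {f : A ⇒ B} → unitʳ ∘ (f ⊗₁ id) ∘ unitʳ † ≈ f
  ρ-conj {f = f} = begin
    unitʳ ∘ (f ⊗₁ id) ∘ unitʳ †       ≈⟨ sym assoc ⟩
    (unitʳ ∘ (f ⊗₁ id)) ∘ unitʳ †     ≈⟨ unitʳ-natural ⟩∘⟨ refl ⟩
    (f ∘ unitʳ) ∘ unitʳ †             ≈⟨ assoc ⟩
    f ∘ unitʳ ∘ unitʳ †               ≈⟨ refl ⟩∘⟨ proj₂ unitʳ-unitary ⟩
    f ∘ id                            ≈⟨ identityʳ ⟩
    f                                 ∎

  I⊗-faithful : ∀ {A B} {f g : A ⇒ B} → id {I} ⊗₁ f ≈ id ⊗₁ g → f ≈ g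
  I⊗-faithful eq = trans (sym λ-conj) (trans (refl ⟩∘⟨ eq ⟩∘⟨ refl) λ-conj)

  ⊗I-faithful : ∀ {A B} {f g : A ⇒ B} → f ⊗₁ id {I} ≈ g ⊗₁ id → f ≈ g
  ⊗I-faithful eq = trans (sym ρ-conj) (trans (refl ⟩∘⟨ eq ⟩∘⟨ refl) ρ-conj)

  λ†-natural : ∀ {A B} {f : A ⇒ B} → unitˡ † ∘ f ≈ (id ⊗₁ f) ∘ unitˡ †
  λ†-natural {f = f} = begin
    unitˡ † ∘ f                                  ≈⟨ refl ⟩∘⟨ sym λ-conj ⟩
    unitˡ † ∘ unitˡ ∘ (id ⊗₁ f) ∘ unitˡ †        ≈⟨ sym assoc ⟩
    (unitˡ † ∘ unitˡ) ∘ (id ⊗₁ f) ∘ unitˡ †      ≈⟨ λ†λ ⟩∘⟨ refl ⟩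
    id ∘ (id ⊗₁ f) ∘ unitˡ †                     ≈⟨ identityˡ ⟩
    (id ⊗₁ f) ∘ unitˡ †                          ∎

  -- Kelly's coherence lemma  λ_{A⊗B} ∘ α = λ_A ⊗ id,  from the pentagon and
  -- the triangle, after tensoring with I on the left.
  unitˡ-α : ∀ {A B} → unitˡ {A ⊗ B} ∘ α {I} {A} {B} ≈ unitˡ ⊗₁ id
  unitˡ-α {A} {B} = I⊗-faithful (cancelʳ P-inverse pentagon-triangle)
    where
    P : (((I ⊗ I) ⊗ A) ⊗ B) ⇒ I ⊗ ((I ⊗ A) ⊗ B)
    P = α ∘ (α ⊗₁ id)
    P-inverse : P ∘ ((α † ⊗₁ id) ∘ α †) ≈ id
    P-inverse = begin
      (α ∘ (α ⊗₁ id)) ∘ ((α † ⊗₁ id) ∘ α †)   ≈⟨ assoc ⟩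
      α ∘ (α ⊗₁ id) ∘ (α † ⊗₁ id) ∘ α †       ≈⟨ refl ⟩∘⟨ sym assoc ⟩
      α ∘ ((α ⊗₁ id) ∘ (α † ⊗₁ id)) ∘ α †     ≈⟨ refl ⟩∘⟨ sym ⊗-∘ˡ ⟩∘⟨ refl ⟩
      α ∘ ((α ∘ α †) ⊗₁ id) ∘ α †             ≈⟨ refl ⟩∘⟨ (proj₂ α-unitary ⟩⊗⟨ refl) ⟩∘⟨ refl ⟩
      α ∘ (id ⊗₁ id) ∘ α †                    ≈⟨ refl ⟩∘⟨ ⊗-id ⟩∘⟨ refl ⟩
      α ∘ id ∘ α †                            ≈⟨ refl ⟩∘⟨ identityˡ ⟩
      α ∘ α †                                 ≈⟨ proj₂ α-unitary ⟩
      id                                      ∎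
    pentagon-triangle : (id ⊗₁ (unitˡ ∘ α)) ∘ P ≈ (id ⊗₁ (unitˡ ⊗₁ id)) ∘ P
    pentagon-triangle = begin
      (id ⊗₁ (unitˡ ∘ α)) ∘ P                        ≈⟨ ⊗-∘ʳ ⟩∘⟨ refl ⟩
      ((id ⊗₁ unitˡ) ∘ (id ⊗₁ α)) ∘ α ∘ (α ⊗₁ id)    ≈⟨ assoc ⟩
      (id ⊗₁ unitˡ) ∘ (id ⊗₁ α) ∘ α ∘ (α ⊗₁ id)      ≈⟨ refl ⟩∘⟨ sym pentagon ⟩
      (id ⊗₁ unitˡ) ∘ α ∘ α                          ≈⟨ sym assoc ⟩
      ((id ⊗₁ unitˡ) ∘ α) ∘ α                        ≈⟨ triangle ⟩∘⟨ refl ⟩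
      (unitʳ ⊗₁ id) ∘ α                              ≈⟨ (refl ⟩⊗⟨ sym ⊗-id) ⟩∘⟨ refl ⟩
      (unitʳ ⊗₁ (id ⊗₁ id)) ∘ α                      ≈⟨ sym α-natural ⟩
      α ∘ ((unitʳ ⊗₁ id) ⊗₁ id)                      ≈⟨ refl ⟩∘⟨ (sym triangle ⟩⊗⟨ refl) ⟩
      α ∘ (((id ⊗₁ unitˡ) ∘ α) ⊗₁ id)                ≈⟨ refl ⟩∘⟨ ⊗-∘ˡ ⟩
      α ∘ ((id ⊗₁ unitˡ) ⊗₁ id) ∘ (α ⊗₁ id)          ≈⟨ sym assoc ⟩
      (α ∘ ((id ⊗₁ unitˡ) ⊗₁ id)) ∘ (α ⊗₁ id)        ≈⟨ α-natural ⟩∘⟨ refl ⟩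
      ((id ⊗₁ (unitˡ ⊗₁ id)) ∘ α) ∘ (α ⊗₁ id)        ≈⟨ assoc ⟩
      (id ⊗₁ (unitˡ ⊗₁ id)) ∘ P                      ∎

  unitˡ-I⊗ : ∀ {A} → unitˡ {I ⊗ A} ≈ id ⊗₁ unitˡ
  unitˡ-I⊗ = cancelˡ λ†λ (sym unitˡ-natural)

  unitˡ≈unitʳ : unitˡ {I} ≈ unitʳ
  unitˡ≈unitʳ = ⊗I-faithful (trans (sym unitˡ-α) (trans (unitˡ-I⊗ ⟩∘⟨ refl) triangle))

  -- Additivity of - ⊗ D, derived from the distributivity isomorphism dis.

  dis⁻¹ : ∀ {A B D} → (A ⊗ D) ⊕ (B ⊗ D) ⇒ (A ⊕ B) ⊗ D
  dis⁻¹ = [ κ₁ ⊗₁ id , κ₂ ⊗₁ id ]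

  -- 𝟘 ⊗ D is a zero object: dis identifies its two coprojections.
  𝟘⊗-trivial : ∀ {D} → id {𝟘 ⊗ D} ≈ 0h
  𝟘⊗-trivial {D} = trans (sym π₁κ₁) (trans (refl ⟩∘⟨ κ₁≈κ₂) π₁κ₂)
    where
    κ₁≈κ₂ : κ₁ {𝟘 ⊗ D} {𝟘 ⊗ D} ≈ κ₂
    κ₁≈κ₂ = begin
      κ₁                   ≈⟨ sym identityˡ ⟩
      id ∘ κ₁              ≈⟨ sym dis-inverseˡ ⟩∘⟨ refl ⟩
      (dis ∘ dis⁻¹) ∘ κ₁   ≈⟨ assoc ⟩
      dis ∘ dis⁻¹ ∘ κ₁     ≈⟨ refl ⟩∘⟨ []κ₁ ⟩
      dis ∘ (κ₁ ⊗₁ id)     ≈⟨ refl ⟩∘⟨ (𝟘-initial κ₁ κ₂ ⟩⊗⟨ refl) ⟩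
      dis ∘ (κ₂ ⊗₁ id)     ≈⟨ refl ⟩∘⟨ sym []κ₂ ⟩
      dis ∘ dis⁻¹ ∘ κ₂     ≈⟨ sym assoc ⟩
      (dis ∘ dis⁻¹) ∘ κ₂   ≈⟨ dis-inverseˡ ⟩∘⟨ refl ⟩
      id ∘ κ₂              ≈⟨ identityˡ ⟩
      κ₂                   ∎

  0⊗id : ∀ {A B D} → 0h {A} {B} ⊗₁ id {D} ≈ 0h
  0⊗id = begin
    0h ⊗₁ id                                 ≈⟨ sym (∘-zeroʳ {f = 0h {𝟘}}) ⟩⊗⟨ refl ⟩
    (0h ∘ 0h) ⊗₁ id                          ≈⟨ ⊗-∘ˡ ⟩
    (0h ⊗₁ id) ∘ (0h ⊗₁ id)                  ≈⟨ refl ⟩∘⟨ sym identityˡ ⟩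
    (0h ⊗₁ id) ∘ id ∘ (0h ⊗₁ id)             ≈⟨ refl ⟩∘⟨ 𝟘⊗-trivial ⟩∘⟨ refl ⟩
    (0h ⊗₁ id) ∘ 0h ∘ (0h ⊗₁ id)             ≈⟨ refl ⟩∘⟨ ∘-zeroˡ ⟩
    (0h ⊗₁ id) ∘ 0h                          ≈⟨ ∘-zeroʳ ⟩
    0h                                       ∎

  ⊗id-via-dis : ∀ {A B D F} {f : A ⊕ B ⇒ F}
              → f ⊗₁ id {D} ≈ [ (f ∘ κ₁) ⊗₁ id , (f ∘ κ₂) ⊗₁ id ] ∘ dis
  ⊗id-via-dis {f = f} = begin
    f ⊗₁ id                                                    ≈⟨ sym identityʳ ⟩
    (f ⊗₁ id) ∘ id                                             ≈⟨ refl ⟩∘⟨ sym dis-inverseʳ ⟩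
    (f ⊗₁ id) ∘ dis⁻¹ ∘ dis                                    ≈⟨ sym assoc ⟩
    ((f ⊗₁ id) ∘ dis⁻¹) ∘ dis                                  ≈⟨ ∘[] ⟩∘⟨ refl ⟩
    [ (f ⊗₁ id) ∘ (κ₁ ⊗₁ id) , (f ⊗₁ id) ∘ (κ₂ ⊗₁ id) ] ∘ dis  ≈⟨ [ sym ⊗-∘ˡ ⟩,⟨ sym ⊗-∘ˡ ] ⟩∘⟨ refl ⟩
    [ (f ∘ κ₁) ⊗₁ id , (f ∘ κ₂) ⊗₁ id ] ∘ dis                  ∎

  π₁∘dis : ∀ {A B D} → π₁ ∘ dis {A} {B} {D} ≈ π₁ ⊗₁ id
  π₁∘dis = sym (begin
    π₁ ⊗₁ id                                     ≈⟨ ⊗id-via-dis ⟩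
    [ (π₁ ∘ κ₁) ⊗₁ id , (π₁ ∘ κ₂) ⊗₁ id ] ∘ dis  ≈⟨ [ trans (π₁κ₁ ⟩⊗⟨ refl) ⊗-id ⟩,⟨ trans (π₁κ₂ ⟩⊗⟨ refl) 0⊗id ] ⟩∘⟨ refl ⟩
    [ id , 0h ] ∘ dis                            ≈⟨ [id,0]≈π₁ ⟩∘⟨ refl ⟩
    π₁ ∘ dis                                     ∎)

  π₂∘dis : ∀ {A B D} → π₂ ∘ dis {A} {B} {D} ≈ π₂ ⊗₁ id
  π₂∘dis = sym (begin
    π₂ ⊗₁ id                                     ≈⟨ ⊗id-via-dis ⟩
    [ (π₂ ∘ κ₁) ⊗₁ id , (π₂ ∘ κ₂) ⊗₁ id ] ∘ dis  ≈⟨ [ trans (π₂κ₁ ⟩⊗⟨ refl) 0⊗id ⟩,⟨ trans (π₂κ₂ ⟩⊗⟨ refl) ⊗-id ] ⟩∘⟨ refl ⟩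
    [ 0h , id ] ∘ dis                            ≈⟨ [0,id]≈π₂ ⟩∘⟨ refl ⟩
    π₂ ∘ dis                                     ∎)

  dis-diagonal : ∀ {A D} → dis ∘ (⟨ id , id ⟩ ⊗₁ id {D}) ≈ ⟨ id {A ⊗ D} , id ⟩
  dis-diagonal = ⊕-ext (component π₁∘dis π₁⟨⟩ π₁⟨⟩) (component π₂∘dis π₂⟨⟩ π₂⟨⟩)
    where
    component : ∀ {A D} {π : A ⊕ A ⇒ A} {πd : (A ⊗ D) ⊕ (A ⊗ D) ⇒ A ⊗ D}
              → πd ∘ dis ≈ π ⊗₁ id → π ∘ ⟨ id , id ⟩ ≈ id → πd ∘ ⟨ id , id ⟩ ≈ id
              → πd ∘ (dis ∘ (⟨ id , id ⟩ ⊗₁ id)) ≈ πd ∘ ⟨ id , id ⟩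
    component {π = π} {πd} πdis πdiag πddiag = begin
      πd ∘ (dis ∘ (⟨ id , id ⟩ ⊗₁ id))   ≈⟨ sym assoc ⟩
      (πd ∘ dis) ∘ (⟨ id , id ⟩ ⊗₁ id)   ≈⟨ πdis ⟩∘⟨ refl ⟩
      (π ⊗₁ id) ∘ (⟨ id , id ⟩ ⊗₁ id)    ≈⟨ sym ⊗-∘ˡ ⟩
      (π ∘ ⟨ id , id ⟩) ⊗₁ id            ≈⟨ πdiag ⟩⊗⟨ refl ⟩
      id ⊗₁ id                           ≈⟨ ⊗-id ⟩
      id                                 ≈⟨ sym πddiag ⟩
      πd ∘ ⟨ id , id ⟩                   ∎

  -- - ⊗ D is additive: write f + g as [f, g] ∘ ⟨id, id⟩ and push the
  -- tensor through dis.
  ⊗-+ : ∀ {A B D} {f g : A ⇒ B} → (f + g) ⊗₁ id {D} ≈ f ⊗₁ id + g ⊗₁ id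
  ⊗-+ {f = f} {g} = begin
    (f + g) ⊗₁ id                                                ≈⟨ sym [f,g]∘diagonal ⟩⊗⟨ refl ⟩
    ([ f , g ] ∘ ⟨ id , id ⟩) ⊗₁ id                              ≈⟨ ⊗-∘ˡ ⟩
    ([ f , g ] ⊗₁ id) ∘ (⟨ id , id ⟩ ⊗₁ id)                      ≈⟨ ⊗id-via-dis ⟩∘⟨ refl ⟩
    ([ ([ f , g ] ∘ κ₁) ⊗₁ id , ([ f , g ] ∘ κ₂) ⊗₁ id ] ∘ dis)
      ∘ (⟨ id , id ⟩ ⊗₁ id)                                      ≈⟨ ([ []κ₁ ⟩⊗⟨ refl ⟩,⟨ []κ₂ ⟩⊗⟨ refl ] ⟩∘⟨ refl) ⟩∘⟨ refl ⟩
    ([ f ⊗₁ id , g ⊗₁ id ] ∘ dis) ∘ (⟨ id , id ⟩ ⊗₁ id)          ≈⟨ assoc ⟩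
    [ f ⊗₁ id , g ⊗₁ id ] ∘ dis ∘ (⟨ id , id ⟩ ⊗₁ id)            ≈⟨ refl ⟩∘⟨ dis-diagonal ⟩
    [ f ⊗₁ id , g ⊗₁ id ] ∘ ⟨ id , id ⟩                          ≈⟨ [f,g]∘diagonal ⟩
    f ⊗₁ id + g ⊗₁ id                                            ∎
    where
    [f,g]∘diagonal : ∀ {A B} {f g : A ⇒ B} → [ f , g ] ∘ ⟨ id {A} , id ⟩ ≈ f + g
    [f,g]∘diagonal = trans []∘⟨⟩ (identityʳ ⟩+⟨ identityʳ)

  act : ∀ {X} → I ⇒ I → X ⇒ X
  act u = unitˡ ∘ (u ⊗₁ id) ∘ unitˡ †

  act-resp : ∀ {X} {u v : I ⇒ I} → u ≈ v → act {X} u ≈ act v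
  act-resp eq = refl ⟩∘⟨ (eq ⟩⊗⟨ refl) ⟩∘⟨ refl

  act-id : ∀ {X} → act {X} id ≈ id
  act-id = trans (refl ⟩∘⟨ trans (⊗-id ⟩∘⟨ refl) identityˡ) λλ†

  act-+ : ∀ {X} {u v : I ⇒ I} → act {X} (u + v) ≈ act u + act v
  act-+ = trans (refl ⟩∘⟨ trans (⊗-+ ⟩∘⟨ refl) ∘-distribʳ-+) ∘-distribˡ-+

  act-∘ : ∀ {X B} {g : B ⇒ I} {u : I ⇒ B} → unitˡ ∘ (g ⊗₁ id) ∘ (u ⊗₁ id) ∘ unitˡ † ≈ act {X} (g ∘ u)
  act-∘ = trans (refl ⟩∘⟨ sym assoc) (refl ⟩∘⟨ sym ⊗-∘ˡ ⟩∘⟨ refl)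

  act-· : ∀ {X} {u v : I ⇒ I} → act {X} (u ∘ v) ≈ act u ∘ act v
  act-· {u = u} {v} = begin
    act (u ∘ v)                                                   ≈⟨ sym act-∘ ⟩
    unitˡ ∘ (u ⊗₁ id) ∘ (v ⊗₁ id) ∘ unitˡ †                       ≈⟨ refl ⟩∘⟨ refl ⟩∘⟨ sym identityˡ ⟩
    unitˡ ∘ (u ⊗₁ id) ∘ id ∘ (v ⊗₁ id) ∘ unitˡ †                  ≈⟨ refl ⟩∘⟨ refl ⟩∘⟨ sym λ†λ ⟩∘⟨ refl ⟩
    unitˡ ∘ (u ⊗₁ id) ∘ (unitˡ † ∘ unitˡ) ∘ (v ⊗₁ id) ∘ unitˡ †   ≈⟨ refl ⟩∘⟨ refl ⟩∘⟨ assoc ⟩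
    unitˡ ∘ (u ⊗₁ id) ∘ unitˡ † ∘ act v                           ≈⟨ refl ⟩∘⟨ sym assoc ⟩
    unitˡ ∘ ((u ⊗₁ id) ∘ unitˡ †) ∘ act v                         ≈⟨ sym assoc ⟩
    act u ∘ act v                                                 ∎

  act-central : ∀ {X Y} {u : I ⇒ I} {h : X ⇒ Y} → act u ∘ h ≈ h ∘ act u
  act-central {u = u} {h} = begin
    (unitˡ ∘ (u ⊗₁ id) ∘ unitˡ †) ∘ h           ≈⟨ assoc ⟩
    unitˡ ∘ ((u ⊗₁ id) ∘ unitˡ †) ∘ h           ≈⟨ refl ⟩∘⟨ assoc ⟩
    unitˡ ∘ (u ⊗₁ id) ∘ unitˡ † ∘ h             ≈⟨ refl ⟩∘⟨ refl ⟩∘⟨ λ†-natural ⟩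
    unitˡ ∘ (u ⊗₁ id) ∘ (id ⊗₁ h) ∘ unitˡ †     ≈⟨ refl ⟩∘⟨ sym assoc ⟩
    unitˡ ∘ ((u ⊗₁ id) ∘ (id ⊗₁ h)) ∘ unitˡ †   ≈⟨ refl ⟩∘⟨ ⊗-interchange ⟩∘⟨ refl ⟩
    unitˡ ∘ ((id ⊗₁ h) ∘ (u ⊗₁ id)) ∘ unitˡ †   ≈⟨ sym assoc ⟩
    (unitˡ ∘ ((id ⊗₁ h) ∘ (u ⊗₁ id))) ∘ unitˡ † ≈⟨ sym assoc ⟩∘⟨ refl ⟩
    ((unitˡ ∘ (id ⊗₁ h)) ∘ (u ⊗₁ id)) ∘ unitˡ † ≈⟨ (unitˡ-natural ⟩∘⟨ refl) ⟩∘⟨ refl ⟩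
    ((h ∘ unitˡ) ∘ (u ⊗₁ id)) ∘ unitˡ †         ≈⟨ assoc ⟩∘⟨ refl ⟩
    (h ∘ unitˡ ∘ (u ⊗₁ id)) ∘ unitˡ †           ≈⟨ assoc ⟩
    h ∘ (unitˡ ∘ (u ⊗₁ id)) ∘ unitˡ †           ≈⟨ refl ⟩∘⟨ assoc ⟩
    h ∘ act u                                   ∎

  -- On I itself the action is trivial, because λ_I = ρ_I.
  act-I : ∀ {u : I ⇒ I} → act {I} u ≈ u
  act-I = trans (unitˡ≈unitʳ ⟩∘⟨ refl ⟩∘⟨ †-resp-≈ unitˡ≈unitʳ) ρ-conj

  act-pos : ∀ {X} {u : I ⇒ I} → Positive u → Positive (act {X} u)
  act-pos {X} {u} (Z , g , pg) = Z ⊗ X , (g ⊗₁ id) ∘ unitˡ † , (begin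
    unitˡ ∘ (u ⊗₁ id) ∘ unitˡ †                  ≈⟨ refl ⟩∘⟨ (pg ⟩⊗⟨ refl) ⟩∘⟨ refl ⟩
    unitˡ ∘ ((g † ∘ g) ⊗₁ id) ∘ unitˡ †          ≈⟨ sym act-∘ ⟩
    unitˡ ∘ (g † ⊗₁ id) ∘ (g ⊗₁ id) ∘ unitˡ †    ≈⟨ sym assoc ⟩
    (unitˡ ∘ (g † ⊗₁ id)) ∘ (g ⊗₁ id) ∘ unitˡ †  ≈⟨ sym dagger-of-factor ⟩∘⟨ refl ⟩
    ((g ⊗₁ id) ∘ unitˡ †) † ∘ (g ⊗₁ id) ∘ unitˡ † ∎)
    where
    dagger-of-factor : ((g ⊗₁ id) ∘ unitˡ †) † ≈ unitˡ ∘ (g † ⊗₁ id {X})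
    dagger-of-factor = trans †-∘ (†-involutive ⟩∘⟨ trans ⊗-† (refl ⟩⊗⟨ †-id))

  -- Positive scalars act as positive maps on any positive map, by
  -- centrality:  act u ∘ k† ∘ k = k† ∘ act u ∘ k.
  act-pos∘ : ∀ {X} {u : I ⇒ I} {h : X ⇒ X} → Positive u → Positive h → Positive (act u ∘ h)
  act-pos∘ {X} {u} {h} pu (Z , k , pk) = pos-resp conj≈ (pos-conj k (act-pos {Z} pu))
    where
    conj≈ : k † ∘ act u ∘ k ≈ act u ∘ h
    conj≈ = trans (sym assoc) (trans (sym act-central ⟩∘⟨ refl) (trans assoc (refl ⟩∘⟨ sym pk)))

  scalar-comm : ∀ {u v : I ⇒ I} → u ∘ v ≈ v ∘ u
  scalar-comm = trans (sym act-I ⟩∘⟨ refl) (trans act-central (refl ⟩∘⟨ act-I))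

  scalar-pos : ∀ {u v : I ⇒ I} → Positive u → Positive v → Positive (u ∘ v)
  scalar-pos pu pv = pos-resp (act-I ⟩∘⟨ refl) (act-pos∘ pu pv)

  Pred : ∀ {X} → X ⇒ X ⊕ X → Set (o ⊔ ℓ ⊔ e)
  Pred = IsPosPred C

  pos₁ : ∀ {X} {p : X ⇒ X ⊕ X} → Pred p → Positive (π₁ ∘ p)
  pos₁ (pp₁ , _ , _) = pp₁

  pos₂ : ∀ {X} {p : X ⇒ X ⊕ X} → Pred p → Positive (π₂ ∘ p)
  pos₂ (_ , pp₂ , _) = pp₂

  psum : ∀ {X} {p : X ⇒ X ⊕ X} → Pred p → π₁ ∘ p + π₂ ∘ p ≈ id
  psum (_ , _ , sum) = sum

  mkPred : ∀ {X} {p : X ⇒ X ⊕ X} {a b : X ⇒ X} → Positive a → Positive b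
         → π₁ ∘ p ≈ a → π₂ ∘ p ≈ b → a + b ≈ id → Pred p
  mkPred pa pb e₁ e₂ sum = pos-resp (sym e₁) pa , pos-resp (sym e₂) pb , trans (e₁ ⟩+⟨ e₂) sum

  -- A predicate is determined by its first component, since p₂ = id − p₁.
  pred-ext : ∀ {X} {p q : X ⇒ X ⊕ X} → Pred p → Pred q → π₁ ∘ p ≈ π₁ ∘ q → p ≈ q
  pred-ext pp pq eq = ⊕-ext eq (+-cancelˡ (trans (psum pp) (trans (sym (psum pq)) (sym eq ⟩+⟨ refl))))

  -- Splitting the first component of a predicate x along a₁ + a₂ = id gives
  -- the predicate (a₁ ∘ x₁ , a₂ ∘ x₁ + x₂); this is the shape of both the
  -- product of probabilities and the action of probabilities.
  pred-rescale : ∀ {X} {x y : X ⇒ X ⊕ X} {a₁ a₂ : X ⇒ X} → Pred x → a₁ + a₂ ≈ id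
               → Positive (a₁ ∘ (π₁ ∘ x)) → Positive (a₂ ∘ (π₁ ∘ x))
               → π₁ ∘ y ≈ a₁ ∘ (π₁ ∘ x) → π₂ ∘ y ≈ a₂ ∘ (π₁ ∘ x) + π₂ ∘ x → Pred y
  pred-rescale {x = x} {a₁ = a₁} {a₂} px a-sum pa₁ pa₂ e₁ e₂ =
    mkPred pa₁ (pos-+ pa₂ (pos₂ px)) e₁ e₂ (begin
      a₁ ∘ (π₁ ∘ x) + (a₂ ∘ (π₁ ∘ x) + π₂ ∘ x)   ≈⟨ sym +-assoc ⟩
      (a₁ ∘ (π₁ ∘ x) + a₂ ∘ (π₁ ∘ x)) + π₂ ∘ x   ≈⟨ sym ∘-distribʳ-+ ⟩+⟨ refl ⟩
      (a₁ + a₂) ∘ (π₁ ∘ x) + π₂ ∘ x              ≈⟨ (a-sum ⟩∘⟨ refl) ⟩+⟨ refl ⟩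
      id ∘ (π₁ ∘ x) + π₂ ∘ x                     ≈⟨ identityˡ ⟩+⟨ refl ⟩
      π₁ ∘ x + π₂ ∘ x                            ≈⟨ psum px ⟩
      id                                         ∎)

  swap-π₁ : ∀ {A X} {y : A ⇒ X ⊕ X} → π₁ ∘ (swap ∘ y) ≈ π₂ ∘ y
  swap-π₁ = trans (refl ⟩∘⟨ []∘) (trans ∘-distribˡ-+ (trans (π₁κ₂∘ ⟩+⟨ π₁κ₁∘) +-identityˡ))

  swap-π₂ : ∀ {A X} {y : A ⇒ X ⊕ X} → π₂ ∘ (swap ∘ y) ≈ π₁ ∘ y
  swap-π₂ = trans (refl ⟩∘⟨ []∘) (trans ∘-distribˡ-+ (trans (π₂κ₂∘ ⟩+⟨ π₂κ₁∘) +-identityʳ))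

  module BoundComponents {X : Obj} (b : X ⇒ (X ⊕ X) ⊕ X) where
    left-π₁ : π₁ ∘ ([ id , κ₂ ] ∘ b) ≈ π₁ ∘ π₁ ∘ b
    left-π₁ = trans (refl ⟩∘⟨ []∘) (trans ∘-distribˡ-+ (trans ((refl ⟩∘⟨ identityˡ) ⟩+⟨ π₁κ₂∘) +-identityʳ))

    left-π₂ : π₂ ∘ ([ id , κ₂ ] ∘ b) ≈ π₂ ∘ π₁ ∘ b + π₂ ∘ b
    left-π₂ = trans (refl ⟩∘⟨ []∘) (trans ∘-distribˡ-+ ((refl ⟩∘⟨ identityˡ) ⟩+⟨ π₂κ₂∘))

    right-π₁ : π₁ ∘ ([ [ κ₂ , κ₁ ] , κ₂ ] ∘ b) ≈ π₂ ∘ π₁ ∘ b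
    right-π₁ = trans (refl ⟩∘⟨ []∘) (trans ∘-distribˡ-+ (trans (swap-π₁ ⟩+⟨ π₁κ₂∘) +-identityʳ))

    right-π₂ : π₂ ∘ ([ [ κ₂ , κ₁ ] , κ₂ ] ∘ b) ≈ π₁ ∘ π₁ ∘ b + π₂ ∘ b
    right-π₂ = trans (refl ⟩∘⟨ []∘) (trans ∘-distribˡ-+ (swap-π₂ ⟩+⟨ π₂κ₂∘))

    sum-π₁ : π₁ ∘ ((∇ ⊕₁ id) ∘ b) ≈ π₁ ∘ π₁ ∘ b + π₂ ∘ π₁ ∘ b
    sum-π₁ = trans (extendʳ π₁⟨⟩) (trans []∘ (identityˡ ⟩+⟨ identityˡ))

    sum-π₂ : π₂ ∘ ((∇ ⊕₁ id) ∘ b) ≈ π₂ ∘ b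
    sum-π₂ = π₂⊕id

  record Decomposition {X} (p q r : X ⇒ X ⊕ X) : Set (o ⊔ ℓ ⊔ e) where
    field
      a b c : X ⇒ X
      pos-a : Positive a
      pos-b : Positive b
      pos-c : Positive c
      π₁p : π₁ ∘ p ≈ a
      π₂p : π₂ ∘ p ≈ b + c
      π₁q : π₁ ∘ q ≈ b
      π₂q : π₂ ∘ q ≈ a + c
      π₁r : π₁ ∘ r ≈ a + b
      π₂r : π₂ ∘ r ≈ c

  decompose : ∀ {X} {p q r : X ⇒ X ⊕ X} → PPSum C p q r → Decomposition p q r
  decompose (b , pa , pb , pc , ep , eq , er) = record
    { a = π₁ ∘ π₁ ∘ b ; b = π₂ ∘ π₁ ∘ b ; c = π₂ ∘ b
    ; pos-a = pa ; pos-b = pb ; pos-c = pc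
    ; π₁p = trans (refl ⟩∘⟨ sym ep) left-π₁ ; π₂p = trans (refl ⟩∘⟨ sym ep) left-π₂
    ; π₁q = trans (refl ⟩∘⟨ sym eq) right-π₁ ; π₂q = trans (refl ⟩∘⟨ sym eq) right-π₂
    ; π₁r = trans (refl ⟩∘⟨ sym er) sum-π₁ ; π₂r = trans (refl ⟩∘⟨ sym er) sum-π₂ }
    where open BoundComponents b

  -- Conversely, between predicates p, q, r it suffices to know the first
  -- components p = (a, _), q = (b, _) and r = (a + b, c): the bound is
  -- ⟨⟨a, b⟩, c⟩, and the missing second components follow by cancellation.
  mkSum : ∀ {X} {p q r : X ⇒ X ⊕ X} {a b c : X ⇒ X} → Pred p → Pred q → Pred r
        → Positive a → Positive b → Positive c
        → π₁ ∘ p ≈ a → π₁ ∘ q ≈ b → π₁ ∘ r ≈ a + b → π₂ ∘ r ≈ c → PPSum C p q r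
  mkSum {X} {p} {q} {r} {a} {b} {c} pp pq pr pa pb pc π₁p π₁q π₁r π₂r =
    bound , pos-resp (sym cell-a) pa , pos-resp (sym cell-b) pb , pos-resp (sym cell-c) pc ,
    ⊕-ext (trans left-π₁ (trans cell-a (sym π₁p))) (trans left-π₂ (trans (cell-b ⟩+⟨ cell-c) (sym π₂p))) ,
    ⊕-ext (trans right-π₁ (trans cell-b (sym π₁q))) (trans right-π₂ (trans (cell-a ⟩+⟨ cell-c) (sym π₂q))) ,
    ⊕-ext (trans sum-π₁ (trans (cell-a ⟩+⟨ cell-b) (sym π₁r))) (trans sum-π₂ (trans cell-c (sym π₂r)))
    where
    bound : X ⇒ (X ⊕ X) ⊕ X
    bound = ⟨ ⟨ a , b ⟩ , c ⟩
    open BoundComponents bound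
    cell-a : π₁ ∘ π₁ ∘ bound ≈ a
    cell-a = trans (refl ⟩∘⟨ π₁⟨⟩) π₁⟨⟩
    cell-b : π₂ ∘ π₁ ∘ bound ≈ b
    cell-b = trans (refl ⟩∘⟨ π₁⟨⟩) π₂⟨⟩
    cell-c : π₂ ∘ bound ≈ c
    cell-c = π₂⟨⟩
    total : (a + b) + c ≈ id
    total = trans (sym (π₁r ⟩+⟨ π₂r)) (psum pr)
    π₂p : π₂ ∘ p ≈ b + c
    π₂p = +-cancelˡ (trans (sym π₁p ⟩+⟨ refl) (trans (psum pp) (trans (sym total) +-assoc)))
    π₂q : π₂ ∘ q ≈ a + c
    π₂q = +-cancelˡ (trans (sym π₁q ⟩+⟨ refl) (trans (psum pq) (trans (sym total)
            (solve 3 (λ x y z → (x ⊕ₑ y) ⊕ₑ z ⊜ y ⊕ₑ (x ⊕ₑ z)) refl a b c))))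
      where open HomSolver using (solve; _⊜_) renaming (_⊕_ to _⊕ₑ_)

  In-one : ∀ {X} → Pred (κ₁ {X} {X})
  In-one = mkPred pos-id pos-0 π₁κ₁ π₂κ₁ +-identityʳ

  In-zero : ∀ {X} → Pred (κ₂ {X} {X})
  In-zero = mkPred pos-0 pos-id π₁κ₂ π₂κ₂ +-identityˡ

  In-ᗮ : ∀ {X} {p : X ⇒ X ⊕ X} → Pred p → Pred (swap ∘ p)
  In-ᗮ pp = mkPred (pos₂ pp) (pos₁ pp) swap-π₁ swap-π₂ (trans +-comm (psum pp))

  In-Sum : ∀ {X} {x y z : X ⇒ X ⊕ X} → Pred x → Pred y → PPSum C x y z → Pred z
  In-Sum px py s = mkPred (pos-+ pos-a pos-b) pos-c π₁r π₂r (trans +-assoc (trans (sym (π₁p ⟩+⟨ π₂p)) (psum px)))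
    where open Decomposition (decompose s)

  Sum-comm : ∀ {X} {x y z : X ⇒ X ⊕ X} → Pred x → Pred y → PPSum C x y z → PPSum C y x z
  Sum-comm px py s = mkSum py px (In-Sum px py s) pos-b pos-a pos-c π₁q π₁p (trans π₁r +-comm) π₂r
    where open Decomposition (decompose s)

  -- The sum is determined: its first component is a + b = x₁ + y₁ and its
  -- second c is determined by x₂ = b + c.
  Sum-functional : ∀ {X} {x y z z' : X ⇒ X ⊕ X} → PPSum C x y z → PPSum C x y z' → z ≈ z'
  Sum-functional s s' =
    ⊕-ext (trans D.π₁r (trans (sym (D.π₁p ⟩+⟨ D.π₁q)) (trans (D'.π₁p ⟩+⟨ D'.π₁q) (sym D'.π₁r))))
          (trans D.π₂r (trans (+-cancelˡ b+c≈b+c') (sym D'.π₂r)))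
    where
    module D = Decomposition (decompose s)
    module D' = Decomposition (decompose s')
    b+c≈b+c' : D.b + D.c ≈ D.b + D'.c
    b+c≈b+c' = trans (sym D.π₂p) (trans D'.π₂p (trans (sym D'.π₁q) D.π₁q ⟩+⟨ refl))

  -- With x ⊞ (y ⊞ z) decomposed as (a₂, b₂, c₂) and y ⊞ z as (a₁, b₁, c₁),
  -- so that b₂ = a₁ + b₁, the intermediate sum is x ⊞ y = (a₂ + a₁, b₁ + c₂).
  Sum-assoc : ∀ {X} {x y z u v : X ⇒ X ⊕ X} → Pred x → Pred y → Pred z → PPSum C y z u → PPSum C x u v
            → Σ (X ⇒ X ⊕ X) (λ w → Pred w × PPSum C x y w × PPSum C w z v)
  Sum-assoc {X} {x} {y} {z} {u} {v} px py pz yz xu = w , pw ,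
    mkSum px py pw D₂.pos-a D₁.pos-a (pos-+ D₁.pos-b D₂.pos-c) D₂.π₁p D₁.π₁p π₁⟨⟩ π₂⟨⟩ ,
    mkSum pw pz pv (pos-+ D₂.pos-a D₁.pos-a) D₁.pos-b D₂.pos-c π₁⟨⟩ D₁.π₁q π₁v D₂.π₂r
    where
    module D₁ = Decomposition (decompose yz)
    module D₂ = Decomposition (decompose xu)
    pv : Pred v
    pv = In-Sum px (In-Sum py pz yz) xu
    w : X ⇒ X ⊕ X
    w = ⟨ D₂.a + D₁.a , D₁.b + D₂.c ⟩
    b₂≈a₁+b₁ : D₂.b ≈ D₁.a + D₁.b
    b₂≈a₁+b₁ = trans (sym D₂.π₁q) D₁.π₁r
    pw : Pred w
    pw = mkPred (pos-+ D₂.pos-a D₁.pos-a) (pos-+ D₁.pos-b D₂.pos-c) π₁⟨⟩ π₂⟨⟩ (begin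
      (D₂.a + D₁.a) + (D₁.b + D₂.c)   ≈⟨ solve 4 (λ a b c d → (a ⊕ₑ b) ⊕ₑ (c ⊕ₑ d) ⊜ a ⊕ₑ ((b ⊕ₑ c) ⊕ₑ d)) refl D₂.a D₁.a D₁.b D₂.c ⟩
      D₂.a + ((D₁.a + D₁.b) + D₂.c)   ≈⟨ refl ⟩+⟨ (sym b₂≈a₁+b₁ ⟩+⟨ refl) ⟩
      D₂.a + (D₂.b + D₂.c)            ≈⟨ sym (D₂.π₁p ⟩+⟨ D₂.π₂p) ⟩
      π₁ ∘ x + π₂ ∘ x                 ≈⟨ psum px ⟩
      id                              ∎)
      where open HomSolver using (solve; _⊜_) renaming (_⊕_ to _⊕ₑ_)
    π₁v : π₁ ∘ v ≈ (D₂.a + D₁.a) + D₁.b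
    π₁v = trans D₂.π₁r (trans (refl ⟩+⟨ b₂≈a₁+b₁) (sym +-assoc))

  Sum-identity : ∀ {X} {x : X ⇒ X ⊕ X} → Pred x → PPSum C x κ₂ x
  Sum-identity px = mkSum px In-zero px (pos₁ px) pos-0 (pos₂ px) refl π₁κ₂ (sym +-identityʳ) refl

  ᗮ-sum : ∀ {X} {x : X ⇒ X ⊕ X} → Pred x → PPSum C x (swap ∘ x) κ₁
  ᗮ-sum px = mkSum px (In-ᗮ px) In-one (pos₁ px) (pos₂ px) pos-0 refl swap-π₁ (trans π₁κ₁ (sym (psum px))) π₂κ₁

  -- If x ⊞ y = 1 then c = 0 in the decomposition, so y = (x₂, x₁).
  ᗮ-unique : ∀ {X} {x y : X ⇒ X ⊕ X} → PPSum C x y κ₁ → y ≈ swap ∘ x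
  ᗮ-unique s = ⊕-ext (trans π₁q (trans (sym +-identityʳ) (trans (refl ⟩+⟨ sym c≈0) (trans (sym π₂p) (sym swap-π₁)))))
                     (trans π₂q (trans (refl ⟩+⟨ c≈0) (trans +-identityʳ (trans (sym π₁p) (sym swap-π₂)))))
    where
    open Decomposition (decompose s)
    c≈0 : c ≈ 0h
    c≈0 = trans (sym π₂r) π₂κ₁

  -- If x ⊥ 1 then a + c = 0 with a, c positive; zerosumfreeness gives
  -- a = c = 0, so x = (0, b) with b = 1.
  zero-one : ∀ {X} {x z : X ⇒ X ⊕ X} → PPSum C x κ₁ z → x ≈ κ₂
  zero-one s = ⊕-ext (trans π₁p (trans a≈0 (sym π₁κ₂))) (trans π₂p (trans (b≈id ⟩+⟨ c≈0) (trans +-identityʳ (sym π₂κ₂))))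
    where
    open Decomposition (decompose s)
    a≈0×c≈0 : (a ≈ 0h) × (c ≈ 0h)
    a≈0×c≈0 = zerosumfree a c pos-a pos-c (trans (sym π₂q) π₂κ₁)
    a≈0 : a ≈ 0h
    a≈0 = proj₁ a≈0×c≈0
    c≈0 : c ≈ 0h
    c≈0 = proj₂ a≈0×c≈0
    b≈id : b ≈ id
    b≈id = trans (sym π₁q) π₁κ₁

  Sum-resp : ∀ {X} {x x' y y' z z' : X ⇒ X ⊕ X} → x ≈ x' → y ≈ y' → z ≈ z' → PPSum C x y z → PPSum C x' y' z'
  Sum-resp ex ey ez (b , pa , pb , pc , eb₁ , eb₂ , eb₃) = b , pa , pb , pc , trans eb₁ ex , trans eb₂ ey , trans eb₃ ez

  pPred-isEffectAlgebra : ∀ X → IsEffectAlgebra (pPredEA C X)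
  pPred-isEffectAlgebra X = record
    { ≈-equiv = record { refl = lift refl ; sym = λ eq → lift (sym (lower eq))
                       ; trans = λ eq eq' → lift (trans (lower eq) (lower eq')) }
    ; In-resp = λ eq pp → mkPred (pos₁ pp) (pos₂ pp) (refl ⟩∘⟨ sym (lower eq)) (refl ⟩∘⟨ sym (lower eq)) (psum pp)
    ; Sum-resp = λ ex ey ez → Sum-resp (lower ex) (lower ey) (lower ez)
    ; In-one = In-one
    ; In-zero = In-zero
    ; In-ᗮ = In-ᗮ
    ; ᗮ-resp = λ _ eq → lift (refl ⟩∘⟨ lower eq)
    ; In-Sum = In-Sum
    ; Sum-functional = λ _ _ s s' → lift (Sum-functional s s')
    ; Sum-comm = Sum-comm
    ; Sum-assoc = Sum-assoc
    ; Sum-identity = Sum-identity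
    ; ᗮ-sum = ᗮ-sum
    ; ᗮ-unique = λ _ _ s → lift (ᗮ-unique s)
    ; zero-one = λ _ s → lift (zero-one s)
    }

  -- Sums are preserved by every map h on predicates whose first component
  -- is computed by an additive, positivity-preserving φ: it sends the
  -- decomposition (a, b, c) of x ⊞ y to one with cells (φ a, φ b, _).
  preserves-sums : ∀ {X Y} (h : X ⇒ X ⊕ X → Y ⇒ Y ⊕ Y) (φ : X ⇒ X → Y ⇒ Y)
    → (∀ {x} → Pred x → Pred (h x))
    → (∀ {x} → π₁ ∘ h x ≈ φ (π₁ ∘ x))
    → (∀ {a a'} → a ≈ a' → φ a ≈ φ a')
    → (∀ {a b} → φ (a + b) ≈ φ a + φ b)
    → (∀ {a} → Positive a → Positive (φ a))
    → ∀ {x y z} → Pred x → Pred y → PPSum C x y z → PPSum C (h x) (h y) (h z)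
  preserves-sums h φ In-h h-π₁ φ-resp φ-+ φ-pos {z = z} px py s =
    mkSum (In-h px) (In-h py) (In-h pz) (φ-pos pos-a) (φ-pos pos-b) (pos₂ (In-h pz))
          (trans h-π₁ (φ-resp π₁p)) (trans h-π₁ (φ-resp π₁q)) (trans h-π₁ (trans (φ-resp π₁r) φ-+)) refl
    where
    open Decomposition (decompose s)
    pz : Pred z
    pz = In-Sum px py s

  -- Pr(C) is a commutative effect monoid: the product composes first
  -- components, and scalars commute.

  ·-π₁ : ∀ {A B D F} {p : A ⇒ B ⊕ D} {q : F ⇒ A ⊕ D} → π₁ ∘ ([ p , κ₂ ] ∘ q) ≈ (π₁ ∘ p) ∘ (π₁ ∘ q)
  ·-π₁ = trans (refl ⟩∘⟨ []∘) (trans ∘-distribˡ-+ (trans (sym assoc ⟩+⟨ π₁κ₂∘) +-identityʳ))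

  ·-π₂ : ∀ {A B D F} {p : A ⇒ B ⊕ D} {q : F ⇒ A ⊕ D} → π₂ ∘ ([ p , κ₂ ] ∘ q) ≈ (π₂ ∘ p) ∘ (π₁ ∘ q) + π₂ ∘ q
  ·-π₂ = trans (refl ⟩∘⟨ []∘) (trans ∘-distribˡ-+ (sym assoc ⟩+⟨ π₂κ₂∘))

  In-· : ∀ {p q : I ⇒ I ⊕ I} → Pred p → Pred q → Pred ([ p , κ₂ ] ∘ q)
  In-· pp pq = pred-rescale pq (psum pp) (scalar-pos (pos₁ pp) (pos₁ pq)) (scalar-pos (pos₂ pp) (pos₁ pq)) ·-π₁ ·-π₂

  Pr-isCommEffectMonoid : IsCommEffectMonoid (Pr C)
  Pr-isCommEffectMonoid = record
    { isEffectAlgebra = pPred-isEffectAlgebra I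
    ; In-· = In-·
    ; ·-resp = λ _ _ ea eb → lift ([ lower ea ⟩,⟨ refl ] ⟩∘⟨ lower eb)
    ; ·-assoc = λ pa pb pd → lift (pred-ext (In-· (In-· pa pb) pd) (In-· pa (In-· pb pd))
        (trans ·-π₁ (trans (·-π₁ ⟩∘⟨ refl) (trans assoc (sym (trans ·-π₁ (refl ⟩∘⟨ ·-π₁)))))))
    ; ·-identityˡ = λ pa → lift (pred-ext (In-· In-one pa) pa (trans ·-π₁ (trans (π₁κ₁ ⟩∘⟨ refl) identityˡ)))
    ; ·-identityʳ = λ pa → lift (pred-ext (In-· pa In-one) pa (trans ·-π₁ (trans (refl ⟩∘⟨ π₁κ₁) identityʳ)))
    ; ·-comm = λ pa pb → lift (pred-ext (In-· pa pb) (In-· pb pa) (trans ·-π₁ (trans scalar-comm (sym ·-π₁))))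
    ; ·-Sumˡ = λ {r} pr → preserves-sums ([ r , κ₂ ] ∘_) ((π₁ ∘ r) ∘_) (In-· pr) ·-π₁
                            (refl ⟩∘⟨_) ∘-distribˡ-+ (scalar-pos (pos₁ pr))
    ; ·-Sumʳ = λ {r} pr → preserves-sums (λ x → [ x , κ₂ ] ∘ r) (_∘ (π₁ ∘ r)) (λ px → In-· px pr) ·-π₁
                            (_⟩∘⟨ refl) ∘-distribʳ-+ (λ pa → scalar-pos pa (pos₁ pr))
    }

  -- pPred(X) is an effect module: scal s p has first component
  -- act s₁ ∘ p₁ and second component act s₂ ∘ p₁ + p₂.

  module ScalComponents {X : Obj} (s : I ⇒ I ⊕ I) (p : X ⇒ X ⊕ X) where
    -- The first three stages of scal: p₁ is scaled into (I⊗X) ⊕ (I⊗X),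
    -- p₂ is left alone.
    scaled : X ⇒ ((I ⊗ X) ⊕ (I ⊗ X)) ⊕ X
    scaled = (dis ⊕₁ id) ∘ ((s ⊗₁ id) ⊕₁ id) ∘ (unitˡ⁻¹ ⊕₁ id) ∘ p

    scaled-π₁ : π₁ ∘ scaled ≈ dis ∘ (s ⊗₁ id) ∘ unitˡ † ∘ (π₁ ∘ p)
    scaled-π₁ = trans (extendʳ π₁⟨⟩) (refl ⟩∘⟨ trans (extendʳ π₁⟨⟩) (refl ⟩∘⟨ extendʳ π₁⟨⟩))

    scaled-π₂ : π₂ ∘ scaled ≈ π₂ ∘ p
    scaled-π₂ = trans π₂⊕id (trans π₂⊕id π₂⊕id)

    scaled-part : ∀ {πᵢ : I ⊕ I ⇒ I} {πᵢ' : (I ⊗ X) ⊕ (I ⊗ X) ⇒ I ⊗ X} → πᵢ' ∘ dis ≈ πᵢ ⊗₁ id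
                → unitˡ ∘ (πᵢ' ∘ (dis ∘ (s ⊗₁ id) ∘ unitˡ † ∘ (π₁ ∘ p))) ≈ act (πᵢ ∘ s) ∘ (π₁ ∘ p)
    scaled-part {πᵢ} {πᵢ'} πdis = begin
      unitˡ ∘ (πᵢ' ∘ (dis ∘ (s ⊗₁ id) ∘ unitˡ † ∘ (π₁ ∘ p)))  ≈⟨ refl ⟩∘⟨ sym assoc ⟩
      unitˡ ∘ ((πᵢ' ∘ dis) ∘ (s ⊗₁ id) ∘ unitˡ † ∘ (π₁ ∘ p))  ≈⟨ refl ⟩∘⟨ πdis ⟩∘⟨ refl ⟩
      unitˡ ∘ (πᵢ ⊗₁ id) ∘ (s ⊗₁ id) ∘ unitˡ † ∘ (π₁ ∘ p)     ≈⟨ sym assoc³ ⟩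
      (unitˡ ∘ (πᵢ ⊗₁ id) ∘ (s ⊗₁ id) ∘ unitˡ †) ∘ (π₁ ∘ p)   ≈⟨ act-∘ ⟩∘⟨ refl ⟩
      act (πᵢ ∘ s) ∘ (π₁ ∘ p)                                 ∎
      where
      assoc³ : ∀ {A B D F G} {f : F ⇒ G} {g : D ⇒ F} {h : B ⇒ D} {k : A ⇒ B} {l : X ⇒ A}
             → (f ∘ g ∘ h ∘ k) ∘ l ≈ f ∘ g ∘ h ∘ k ∘ l
      assoc³ = trans assoc (refl ⟩∘⟨ trans assoc (refl ⟩∘⟨ assoc))

    scal-π₁ : π₁ ∘ scal C s p ≈ act (π₁ ∘ s) ∘ (π₁ ∘ p)
    scal-π₁ = begin
      π₁ ∘ ([ unitˡ ⊕₁ unitˡ , κ₂ ] ∘ scaled)                                    ≈⟨ refl ⟩∘⟨ []∘ ⟩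
      π₁ ∘ ((unitˡ ⊕₁ unitˡ) ∘ (π₁ ∘ scaled) + κ₂ ∘ (π₂ ∘ scaled))               ≈⟨ ∘-distribˡ-+ ⟩
      π₁ ∘ ((unitˡ ⊕₁ unitˡ) ∘ (π₁ ∘ scaled)) + π₁ ∘ (κ₂ ∘ (π₂ ∘ scaled))        ≈⟨ extendʳ π₁⟨⟩ ⟩+⟨ π₁κ₂∘ ⟩
      unitˡ ∘ (π₁ ∘ (π₁ ∘ scaled)) + 0h                                          ≈⟨ +-identityʳ ⟩
      unitˡ ∘ (π₁ ∘ (π₁ ∘ scaled))                                               ≈⟨ refl ⟩∘⟨ refl ⟩∘⟨ scaled-π₁ ⟩
      unitˡ ∘ (π₁ ∘ (dis ∘ (s ⊗₁ id) ∘ unitˡ † ∘ (π₁ ∘ p)))                      ≈⟨ scaled-part π₁∘dis ⟩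
      act (π₁ ∘ s) ∘ (π₁ ∘ p)                                                    ∎

    scal-π₂ : π₂ ∘ scal C s p ≈ act (π₂ ∘ s) ∘ (π₁ ∘ p) + π₂ ∘ p
    scal-π₂ = begin
      π₂ ∘ ([ unitˡ ⊕₁ unitˡ , κ₂ ] ∘ scaled)                                    ≈⟨ refl ⟩∘⟨ []∘ ⟩
      π₂ ∘ ((unitˡ ⊕₁ unitˡ) ∘ (π₁ ∘ scaled) + κ₂ ∘ (π₂ ∘ scaled))               ≈⟨ ∘-distribˡ-+ ⟩
      π₂ ∘ ((unitˡ ⊕₁ unitˡ) ∘ (π₁ ∘ scaled)) + π₂ ∘ (κ₂ ∘ (π₂ ∘ scaled))        ≈⟨ extendʳ π₂⟨⟩ ⟩+⟨ π₂κ₂∘ ⟩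
      unitˡ ∘ (π₂ ∘ (π₁ ∘ scaled)) + π₂ ∘ scaled                                 ≈⟨ (refl ⟩∘⟨ refl ⟩∘⟨ scaled-π₁) ⟩+⟨ scaled-π₂ ⟩
      unitˡ ∘ (π₂ ∘ (dis ∘ (s ⊗₁ id) ∘ unitˡ † ∘ (π₁ ∘ p))) + π₂ ∘ p             ≈⟨ scaled-part π₂∘dis ⟩+⟨ refl ⟩
      act (π₂ ∘ s) ∘ (π₁ ∘ p) + π₂ ∘ p                                           ∎

  open ScalComponents using (scal-π₁; scal-π₂)

  In-• : ∀ {X} {r : I ⇒ I ⊕ I} {x : X ⇒ X ⊕ X} → Pred r → Pred x → Pred (scal C r x)
  In-• {r = r} {x} pr px = pred-rescale px act-sum (act-pos∘ (pos₁ pr) (pos₁ px)) (act-pos∘ (pos₂ pr) (pos₁ px))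
                             (scal-π₁ r x) (scal-π₂ r x)
    where
    act-sum : act (π₁ ∘ r) + act (π₂ ∘ r) ≈ id
    act-sum = trans (sym act-+) (trans (act-resp (psum pr)) act-id)

  pPred-isEffectModule : ∀ X → IsEffectModule (Pr C) (pPred C X)
  pPred-isEffectModule X = record
    { isEffectAlgebra = pPred-isEffectAlgebra X
    ; In-• = In-•
    ; •-resp = λ _ _ er ex → lift (refl ⟩∘⟨ refl ⟩∘⟨ ((lower er ⟩⊗⟨ refl) ⟩⊕⟨ refl) ⟩∘⟨ refl ⟩∘⟨ lower ex)
    ; •-Sumˡ = λ {_} {_} {_} {x} pr ps px →
        preserves-sums (λ r → scal C r x) (λ u → act u ∘ (π₁ ∘ x)) (λ pr → In-• pr px) (scal-π₁ _ x)
          (λ eq → act-resp eq ⟩∘⟨ refl) (trans (act-+ ⟩∘⟨ refl) ∘-distribʳ-+) (λ pu → act-pos∘ pu (pos₁ px)) pr ps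
    ; •-Sumʳ = λ {r} pr →
        preserves-sums (scal C r) (act (π₁ ∘ r) ∘_) (In-• pr) (scal-π₁ r _)
          (refl ⟩∘⟨_) ∘-distribˡ-+ (act-pos∘ (pos₁ pr))
    ; •-assoc = λ {r} {s} {x} pr ps px → lift (pred-ext (In-• (In-· pr ps) px) (In-• pr (In-• ps px)) (begin
        π₁ ∘ scal C ([ r , κ₂ ] ∘ s) x                 ≈⟨ scal-π₁ _ x ⟩
        act (π₁ ∘ ([ r , κ₂ ] ∘ s)) ∘ (π₁ ∘ x)        ≈⟨ act-resp ·-π₁ ⟩∘⟨ refl ⟩
        act ((π₁ ∘ r) ∘ (π₁ ∘ s)) ∘ (π₁ ∘ x)          ≈⟨ act-· ⟩∘⟨ refl ⟩
        (act (π₁ ∘ r) ∘ act (π₁ ∘ s)) ∘ (π₁ ∘ x)      ≈⟨ assoc ⟩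
        act (π₁ ∘ r) ∘ (act (π₁ ∘ s) ∘ (π₁ ∘ x))      ≈⟨ refl ⟩∘⟨ sym (scal-π₁ s x) ⟩
        act (π₁ ∘ r) ∘ (π₁ ∘ scal C s x)              ≈⟨ sym (scal-π₁ r _) ⟩
        π₁ ∘ scal C r (scal C s x)                     ∎))
    ; •-identity = λ {x} px → lift (pred-ext (In-• In-one px) px
        (trans (scal-π₁ κ₁ x) (trans (act-resp π₁κ₁ ⟩∘⟨ refl) (trans (act-id ⟩∘⟨ refl) identityˡ))))
    }

  conj : ∀ {X Y} → X ⇒ Y → Y ⇒ Y → X ⇒ X
  conj f a = f † ∘ a ∘ f

  subst-π₁ : ∀ {X Y} {f : X ⇒ Y} {q : Y ⇒ Y ⊕ Y} → π₁ ∘ subst* C f q ≈ conj f (π₁ ∘ q)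
  subst-π₁ = trans (extendʳ π₁⟨⟩) (refl ⟩∘⟨ sym assoc)

  subst-π₂ : ∀ {X Y} {f : X ⇒ Y} {q : Y ⇒ Y ⊕ Y} → π₂ ∘ subst* C f q ≈ conj f (π₂ ∘ q)
  subst-π₂ = trans (extendʳ π₂⟨⟩) (refl ⟩∘⟨ sym assoc)

  conj-+ : ∀ {X Y} {f : X ⇒ Y} {a b : Y ⇒ Y} → conj f (a + b) ≈ conj f a + conj f b
  conj-+ = trans (refl ⟩∘⟨ ∘-distribʳ-+) ∘-distribˡ-+

  conj-id : ∀ {X} {a : X ⇒ X} → conj id a ≈ a
  conj-id = trans (†-id ⟩∘⟨ refl) (trans identityˡ identityʳ)

  conj-∘ : ∀ {X Y Z} {f : X ⇒ Y} {g : Y ⇒ Z} {a : Z ⇒ Z} → conj (g ∘ f) a ≈ conj f (conj g a)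
  conj-∘ {f = f} {g} {a} = begin
    (g ∘ f) † ∘ a ∘ (g ∘ f)     ≈⟨ †-∘ ⟩∘⟨ refl ⟩
    (f † ∘ g †) ∘ a ∘ (g ∘ f)   ≈⟨ assoc ⟩
    f † ∘ g † ∘ a ∘ g ∘ f       ≈⟨ refl ⟩∘⟨ refl ⟩∘⟨ sym assoc ⟩
    f † ∘ g † ∘ (a ∘ g) ∘ f     ≈⟨ refl ⟩∘⟨ sym assoc ⟩
    f † ∘ (g † ∘ a ∘ g) ∘ f     ∎

  conj-dagger-mono : ∀ {X Y} {f : X ⇒ Y} → DaggerMono f → conj f id ≈ id
  conj-dagger-mono dm = trans (refl ⟩∘⟨ identityˡ) dm

  module _ {X Y} (f : X ⇒ Y) (dm : DaggerMono f) where
    In-subst : ∀ {q : Y ⇒ Y ⊕ Y} → Pred q → Pred (subst* C f q)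
    In-subst pq = mkPred (pos-conj f (pos₁ pq)) (pos-conj f (pos₂ pq)) subst-π₁ subst-π₂
                         (trans (sym conj-+) (trans (refl ⟩∘⟨ psum pq ⟩∘⟨ refl) (conj-dagger-mono dm)))

    subst-isMorphism : IsEModMorphism (Pr C) (pPred C Y) (pPred C X) (subst* C f)
    subst-isMorphism = record
      { In-h = In-subst
      ; h-resp = λ _ eq → lift (refl ⟩∘⟨ lower eq ⟩∘⟨ refl)
      ; h-one = lift (pred-ext (In-subst In-one) In-one
                  (trans subst-π₁ (trans (refl ⟩∘⟨ π₁κ₁ ⟩∘⟨ refl) (trans (conj-dagger-mono dm) (sym π₁κ₁)))))
      ; h-Sum = preserves-sums (subst* C f) (conj f) In-subst subst-π₁ (λ eq → refl ⟩∘⟨ eq ⟩∘⟨ refl)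
                  conj-+ (pos-conj f)
      ; h-• = λ {r} {x} pr px → lift (pred-ext (In-subst (In-• pr px)) (In-• pr (In-subst px)) (begin
          π₁ ∘ subst* C f (scal C r x)              ≈⟨ subst-π₁ ⟩
          f † ∘ (π₁ ∘ scal C r x) ∘ f               ≈⟨ refl ⟩∘⟨ scal-π₁ r x ⟩∘⟨ refl ⟩
          f † ∘ (act (π₁ ∘ r) ∘ (π₁ ∘ x)) ∘ f       ≈⟨ refl ⟩∘⟨ assoc ⟩
          f † ∘ act (π₁ ∘ r) ∘ (π₁ ∘ x) ∘ f         ≈⟨ sym assoc ⟩
          (f † ∘ act (π₁ ∘ r)) ∘ (π₁ ∘ x) ∘ f       ≈⟨ sym act-central ⟩∘⟨ refl ⟩
          (act (π₁ ∘ r) ∘ f †) ∘ (π₁ ∘ x) ∘ f       ≈⟨ assoc ⟩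
          act (π₁ ∘ r) ∘ f † ∘ (π₁ ∘ x) ∘ f         ≈⟨ refl ⟩∘⟨ sym subst-π₁ ⟩
          act (π₁ ∘ r) ∘ (π₁ ∘ subst* C f x)        ≈⟨ sym (scal-π₁ r _) ⟩
          π₁ ∘ scal C r (subst* C f x)              ∎))
      }

  subst-id : ∀ {X} (q : X ⇒ X ⊕ X) → subst* C id q ≈ q
  subst-id q = ⊕-ext (trans subst-π₁ conj-id) (trans subst-π₂ conj-id)

  subst-∘ : ∀ {X Y Z} {f : X ⇒ Y} {g : Y ⇒ Z} (q : Z ⇒ Z ⊕ Z) → subst* C (g ∘ f) q ≈ subst* C f (subst* C g q)
  subst-∘ q = ⊕-ext (trans subst-π₁ (trans conj-∘ (sym (trans subst-π₁ (refl ⟩∘⟨ subst-π₁ ⟩∘⟨ refl)))))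
                    (trans subst-π₂ (trans conj-∘ (sym (trans subst-π₂ (refl ⟩∘⟨ subst-π₂ ⟩∘⟨ refl)))))

  indexedEMod : (Cls : ∀ {A B} → A ⇒ B → Set e) → (∀ {A} → Cls (id {A}))
              → (∀ {A B D} {f : A ⇒ B} {g : B ⇒ D} → Cls f → Cls g → Cls (g ∘ f))
              → (∀ {A B} {f : A ⇒ B} → Cls f → DaggerMono f) → IsIndexedEMod C Cls
  indexedEMod Cls cls-id cls-∘ cls⇒dagger-mono = record
    { cls-id = cls-id
    ; cls-∘ = cls-∘
    ; Pr-isCommEffectMonoid = Pr-isCommEffectMonoid
    ; pPred-isEffectModule = pPred-isEffectModule
    ; subst-isMorphism = λ f cf → subst-isMorphism f (cls⇒dagger-mono cf)
    ; subst-resp = λ _ _ eq _ _ → (†-resp-≈ eq ⟩⊕⟨ †-resp-≈ eq) ⟩∘⟨ refl ⟩∘⟨ eq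
    ; subst-id = λ q _ → subst-id q
    ; subst-∘ = λ _ _ q _ → subst-∘ q
    }

  dagger-mono-id : ∀ {A} → DaggerMono (id {A})
  dagger-mono-id = trans (†-id ⟩∘⟨ refl) identityˡ

  dagger-mono-∘ : ∀ {A B D} {f : A ⇒ B} {g : B ⇒ D} → DaggerMono f → DaggerMono g → DaggerMono (g ∘ f)
  dagger-mono-∘ {f = f} {g} df dg = begin
    (g ∘ f) † ∘ (g ∘ f)     ≈⟨ sym (refl ⟩∘⟨ identityˡ) ⟩
    conj (g ∘ f) id         ≈⟨ conj-∘ ⟩
    conj f (conj g id)      ≈⟨ refl ⟩∘⟨ conj-dagger-mono dg ⟩∘⟨ refl ⟩
    conj f id               ≈⟨ conj-dagger-mono df ⟩
    id                      ∎

  unitary-id : ∀ {A} → Unitary (id {A})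
  unitary-id = dagger-mono-id , trans (refl ⟩∘⟨ †-id) identityˡ

  unitary-∘ : ∀ {A B D} {f : A ⇒ B} {g : B ⇒ D} → Unitary f → Unitary g → Unitary (g ∘ f)
  unitary-∘ {f = f} {g} (df , df') (dg , dg') = dagger-mono-∘ df dg , (begin
    (g ∘ f) ∘ (g ∘ f) †     ≈⟨ refl ⟩∘⟨ †-∘ ⟩
    (g ∘ f) ∘ (f † ∘ g †)   ≈⟨ assoc ⟩
    g ∘ f ∘ f † ∘ g †       ≈⟨ refl ⟩∘⟨ sym assoc ⟩
    g ∘ (f ∘ f †) ∘ g †     ≈⟨ refl ⟩∘⟨ df' ⟩∘⟨ refl ⟩
    g ∘ id ∘ g †            ≈⟨ refl ⟩∘⟨ identityˡ ⟩
    g ∘ g †                 ≈⟨ dg' ⟩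
    id                      ∎)

proposition8p6 : ∀ {o ℓ e} (C : ZDMACategory o ℓ e)
    → IsIndexedEMod C (ZDMACategory.Unitary C) × IsIndexedEMod C (ZDMACategory.DaggerMono C)
proposition8p6 C = indexedEMod Unitary unitary-id unitary-∘ proj₁
                 , indexedEMod DaggerMono dagger-mono-id dagger-mono-∘ (λ dm → dm)
  where
  open ZDMACategory C using (Unitary; DaggerMono)
  open Proof C
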